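{- Let $D$ be a larva or a pupa with head $v$. Then $v$ is undesirable in $D$. Let $T$ be a butterfly with head $u$. Then $u$ is desirable in $T$.
   Context: All graphs are finite and simple. A path of length $\ell$ is an induced subgraph with vertices $p_0,\dots,p_\ell$ and exactly the edges $p_ip_{i+1}$; it is odd/even according to the parity of $\ell$. A hole of length $k\ge 4$ is an induced cycle on $k$ vertices; it is even if $k$ is even. A strong stable set of a graph is a stable set meeting every nonempty maximal clique; a graph is strongly perfect if every induced subgraph has a strong stable set. For a strongly perfect graph $G$ and $v\in V(G)$: $v$ is wanted (unwanted) in $G$ if $v\in S$ ($v\notin S$) for every strong stable set $S$ of $G$; $v$ is forced in $G$ if it is wanted or unwanted. $v$ is desirable (undesirable) in $G$ if $v$ is wanted (unwanted) in $G$ and, for every vertex $u\ne v$ of $G$, $v$ is not forced in $G\setminus\{u\}$. A larva is a graph with vertex set $\{v,c_1,\dots,c_k\}$ where $c_1\hbox{ - }c_2\hbox{ - }\dots\hbox{ - }c_k\hbox{ - }c_1$ is an even hole ($k\ge4$ even) and $v$ is adjacent exactly to $c_1,c_2$. A pupa is a graph with vertex set $\{v,c_1,\dots,c_k,p_1,\dots,p_t\}$ where $c_1\hbox{ - }\dots\hbox{ - }c_k\hbox{ - }c_1$ is an even hole, $v\hbox{ - }p_1\hbox{ - }\dots\hbox{ - }p_t\hbox{ - }c_1$ is an odd path, $c_2$ is complete to $\{v,p_1,\dots,p_t,c_1\}$, and there are no other edges. A butterfly is a graph with vertex set $\{v,a_1,\dots,a_k=b_1,b_2,\dots,b_\ell=c_1,c_2,\dots,c_m\}$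 where $a_1\hbox{ - }\dots\hbox{ - }a_k$ is an even path of length at least two, $b_1\hbox{ - }\dots\hbox{ - }b_\ell$ is an odd path, $c_1\hbox{ - }\dots\hbox{ - }c_m$ is an even path of length at least two, $v$ is adjacent to all of $b_1,\dots,b_\ell,a_1,c_m$, and there are no other edges. In each case $v$ is called the head. (Larvas, pupas and butterflies are strongly perfect.) -}

module Defs where

open import Data.Nat using (ℕ; zero; suc; _+_; _∸_; _≤_)
open import Data.Fin using (Fin; toℕ)
open import Data.Fin.Subset using (Subset; _∈_; _∉_; _⊆_; ⊤; _-_; Nonempty)
open import Data.Bool using (Bool; true; false)
open import Data.Maybe using (Maybe; just; nothing)
open import Data.Product using (Σ; ∃; _×_; _,_)
open import Data.Sum using (_⊎_)
open import Relation.Nullary using (¬_)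
open import Relation.Binary.PropositionalEquality using (_≡_; _≢_)

Even : ℕ → Set
Even k = ∃ λ m → k ≡ m + m

Odd : ℕ → Set
Odd k = ∃ λ m → k ≡ suc (m + m)

record Graph (n : ℕ) : Set where
  field
    adj    : Fin n → Fin n → Bool
    sym    : ∀ x y → adj x y ≡ adj y x
    irrefl : ∀ x → adj x x ≡ false

module _ {n : ℕ} (G : Graph n) where
  open Graph G

  Adj : Fin n → Fin n → Set
  Adj x y = adj x y ≡ true

  -- All notions below are relative to the induced subgraph G[X],
  -- X a subset of the vertices.

  IsClique : Subset n → Subset n → Set
  IsClique X K = K ⊆ X × (∀ x y → x ∈ K → y ∈ K → x ≢ y → Adj x y)

  IsMaximalClique : Subset n → Subset n → Set
  IsMaximalClique X K =
    IsClique X K × (∀ K' → IsClique X K' → K ⊆ K' → K' ⊆ K)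

  IsStable : Subset n → Subset n → Set
  IsStable X S = S ⊆ X × (∀ x y → x ∈ S → y ∈ S → ¬ Adj x y)

  IsStrongStable : Subset n → Subset n → Set
  IsStrongStable X S =
    IsStable X S ×
    (∀ K → IsMaximalClique X K → Nonempty K → ∃ λ x → x ∈ S × x ∈ K)

  StronglyPerfect : Subset n → Set
  StronglyPerfect X = ∀ Y → Y ⊆ X → ∃ λ S → IsStrongStable Y S

  Wanted : Subset n → Fin n → Set
  Wanted X v = ∀ S → IsStrongStable X S → v ∈ S

  Unwanted : Subset n → Fin n → Set
  Unwanted X v = ∀ S → IsStrongStable X S → v ∉ S

  Forced : Subset n → Fin n → Set
  Forced X v = Wanted X v ⊎ Unwanted X v

  -- desirable / undesirable in G itself (X = all vertices);
  -- G \ {u} is the induced subgraph on ⊤ - u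
  Desirable : Fin n → Set
  Desirable v = Wanted ⊤ v × (∀ u → u ≢ v → ¬ Forced (⊤ - u) v)

  Undesirable : Fin n → Set
  Undesirable v = Unwanted ⊤ v × (∀ u → u ≢ v → ¬ Forced (⊤ - u) v)

-- G is isomorphic to a model graph on label type L (with edge relation E,
-- taken symmetrically) by a bijection sending the model head h to v.

IsoToModel : {n : ℕ} → Graph n → Fin n →
             (L : Set) → (L → L → Set) → L → Set
IsoToModel {n} G v L E h =
  Σ (L → Fin n) λ f →
    (∀ a b → f a ≡ f b → a ≡ b) ×
    (∀ x → ∃ λ a → f a ≡ x) ×
    f h ≡ v ×
    (∀ a b → (Adj G (f a) (f b) → E a b ⊎ E b a) ×
             (E a b ⊎ E b a → Adj G (f a) (f b)))

-- edges of the hole c_1 - c_2 - ... - c_k - c_1, with c_{i+1} = index i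
CycleEdge : (k : ℕ) → Fin k → Fin k → Set
CycleEdge k i j = suc (toℕ i) ≡ toℕ j ⊎ (suc (toℕ i) ≡ k × toℕ j ≡ 0)

-- Larva: head v and c_1..c_k (c_i is cyc (i-1))
data LarvaLabel (k : ℕ) : Set where
  head : LarvaLabel k
  cyc  : Fin k → LarvaLabel k

LarvaEdge : (k : ℕ) → LarvaLabel k → LarvaLabel k → Set
LarvaEdge k (cyc i) (cyc j) = CycleEdge k i j
LarvaEdge k head (cyc i) = toℕ i ≡ 0 ⊎ toℕ i ≡ 1
LarvaEdge k _ _ = ⊥'
  where open import Data.Empty renaming (⊥ to ⊥')

IsLarva : {n : ℕ} → Graph n → Fin n → Set
IsLarva G v = ∃ λ k → Even k × 4 ≤ k ×
  IsoToModel G v (LarvaLabel k) (LarvaEdge k) head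

-- Pupa: head v, c_1..c_k (cyc (i-1)), p_1..p_t (pth (i-1))
data PupaLabel (k t : ℕ) : Set where
  head : PupaLabel k t
  cyc  : Fin k → PupaLabel k t
  pth  : Fin t → PupaLabel k t

-- position on the path v - p_1 - ... - p_t - c_1 (v at 0, c_1 at t+1)
pupaPos : {k t : ℕ} → PupaLabel k t → Maybe ℕ
pupaPos head = just 0
pupaPos (pth i) = just (suc (toℕ i))
pupaPos {t = t} (cyc i) with toℕ i
... | zero = just (suc t)
... | suc _ = nothing

OnPupaPath : {k t : ℕ} → PupaLabel k t → Set
OnPupaPath a = ∃ λ x → pupaPos a ≡ just x

PupaEdge : (k t : ℕ) → PupaLabel k t → PupaLabel k t → Set
PupaEdge k t a b =
  (∃ λ i → ∃ λ j → a ≡ cyc i × b ≡ cyc j × CycleEdge k i j) ⊎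
  (∃ λ x → pupaPos a ≡ just x × pupaPos b ≡ just (suc x)) ⊎
  -- c_2 complete to {v, p_1, ..., p_t, c_1}
  (∃ λ i → a ≡ cyc i × toℕ i ≡ 1 × OnPupaPath b)

IsPupa : {n : ℕ} → Graph n → Fin n → Set
IsPupa G v = ∃ λ k → ∃ λ t → Even k × 4 ≤ k × Odd (suc t) ×
  IsoToModel G v (PupaLabel k t) (PupaEdge k t) head

-- Butterfly: head v and the path a_1 - ... - a_k = b_1 - ... - b_ℓ = c_1 - ... - c_m,
-- written as w_0 - w_1 - ... - w_N with N = α + β + γ, where
-- α = k-1 (even, ≥ 2), β = ℓ-1 (odd), γ = m-1 (even, ≥ 2) are the path lengths;
-- a_1 = w_0, b_1 = w_α, b_ℓ = c_1 = w_(α+β), c_m = w_N.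
data ButterflyLabel (N : ℕ) : Set where
  head : ButterflyLabel N
  w    : Fin (suc N) → ButterflyLabel N

ButterflyEdge : (α β γ : ℕ) → ButterflyLabel (α + β + γ) →
                ButterflyLabel (α + β + γ) → Set
ButterflyEdge α β γ (w i) (w j) = suc (toℕ i) ≡ toℕ j
ButterflyEdge α β γ head (w i) =
  toℕ i ≡ 0 ⊎ (α ≤ toℕ i × toℕ i ≤ α + β) ⊎ toℕ i ≡ α + β + γ
ButterflyEdge α β γ _ _ = ⊥'
  where open import Data.Empty renaming (⊥ to ⊥')

IsButterfly : {n : ℕ} → Graph n → Fin n → Set
IsButterfly G v = ∃ λ α → ∃ λ β → ∃ λ γ →
  Even α × 2 ≤ α × Odd β × Even γ × 2 ≤ γ ×
  IsoToModel G v (ButterflyLabel (α + β + γ)) (ButterflyEdge α β γ) head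

-- A strong stable set S is certified locally: S is stable, every vertex outside S has a
-- neighbour in S, and every edge outside S has a common neighbour in S adjacent to all common
-- neighbours of its ends outside S.  Conversely S meets every edge or triangle that is a maximal
-- clique, so along the paths of these graphs it alternates.  In a pupa (a larva is a pupa with
-- t = 0) a strong stable set containing v alternates along v - ... - c_1 around the triangles
-- through c_2, and along c_2 - ... - c_k; by parity it then misses both ends of c_k c_1.  In a
-- butterfly one missing u contains a_1, alternates along a_1 - ... - c_m and misses both ends of
-- u c_m.  After deleting any other vertex r the alternation may switch parity at r, and such
-- switched patterns give strong stable sets of G - r both with and without the head.

module Submission where

open import Defs
open import Data.Nat
open import Data.Nat.Properties
open import Data.Nat.DivMod using (_mod_; m≤n⇒m%n≡m)
open import Data.Bool using (Bool; true; false; not)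
open import Data.Bool.Properties using (not-involutive; not-injective; not-¬; ¬-not) renaming (_≟_ to _≟ᵇ_)
open import Data.Fin using (Fin; toℕ; fromℕ<) renaming (zero to fzero; _≟_ to _≟ᶠ_)
open import Data.Fin.Properties using (any?; all?; toℕ<n; toℕ-injective; toℕ-fromℕ<; fromℕ<-toℕ)
open import Data.Fin.Subset using (Subset; _∈_; _∉_; _⊆_; ⊤; _-_; _─_; _∪_; ⁅_⁆; Nonempty)
open import Data.Fin.Subset.Properties
  using (∈⊤; x∈⁅x⁆; x∈⁅y⁆⇒x≡y; x∈p∪q⁻; x∈p∪q⁺; p⊆p∪q; x∈p∧x≢y⇒x∈p-y; _∈?_)
open import Data.Maybe using (just)
open import Data.Vec using (tabulate; lookup; _∷_; here; there)
open import Data.Vec.Properties using (lookup∘tabulate; []=⇒lookup; lookup⇒[]=)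
open import Data.Unit using (tt) renaming (⊤ to Unit)
open import Data.Product using (∃; _×_; _,_; proj₁; proj₂; map₂)
open import Data.Sum using (_⊎_; inj₁; inj₂; [_,_]′; swap)
open import Data.Empty using (⊥; ⊥-elim)
open import Function.Base using (_∘_)
open import Function.Bundles using (_⇔_; mk⇔; Equivalence)
open import Relation.Nullary using (¬_; Dec; does; yes; no)
open import Relation.Nullary.Decidable using (_×-dec_; _⊎-dec_; _→-dec_; ¬?; dec-true)
open import Relation.Binary.PropositionalEquality
open import Relation.Binary.Definitions using (tri<; tri≈; tri>)
open import Relation.Binary.Construct.Closure.Symmetric
  using (SymClosure; fwd; bwd) renaming (symmetric to ~-symmetric)

-- Strong stable sets

∈-insert⁻ : ∀ {n} {K : Subset n} {x y} → x ∈ K ∪ ⁅ y ⁆ → x ∈ K ⊎ x ≡ y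
∈-insert⁻ {K = K} {y = y} x∈ with x∈p∪q⁻ K ⁅ y ⁆ x∈
... | inj₁ x∈K = inj₁ x∈K
... | inj₂ x∈y = inj₂ (x∈⁅y⁆⇒x≡y y x∈y)

∈-insert⁺ˡ : ∀ {n} {K : Subset n} {x y} → x ∈ K → x ∈ K ∪ ⁅ y ⁆
∈-insert⁺ˡ {y = y} = p⊆p∪q ⁅ y ⁆

∈-insert⁺ʳ : ∀ {n} {K : Subset n} {y} → y ∈ K ∪ ⁅ y ⁆
∈-insert⁺ʳ {y = y} = x∈p∪q⁺ (inj₂ (x∈⁅x⁆ y))

x∈p-y⇒x≢y : ∀ {n} {p : Subset n} {x y} → x ∈ p - y → x ≢ y
x∈p-y⇒x≢y {p = p} {y = y} x∈ refl = x∈p─q⇒x∉q p ⁅ y ⁆ x∈ (x∈⁅x⁆ y)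
  where
  x∈p─q⇒x∉q : ∀ {n} (p q : Subset n) {x} → x ∈ p ─ q → x ∉ q
  x∈p─q⇒x∉q (_ ∷ p) (false ∷ q) here ()
  x∈p─q⇒x∉q (_ ∷ p) (_ ∷ q) (there x∈) (there x∈q) = x∈p─q⇒x∉q p q x∈ x∈q

module _ {n : ℕ} (G : Graph n) where

  Adj-sym : ∀ {x y} → Adj G x y → Adj G y x
  Adj-sym {x} {y} e = trans (Graph.sym G y x) e

  Adj? : ∀ x y → Dec (Adj G x y)
  Adj? x y = Graph.adj G x y ≟ᵇ true

  clique-insert : ∀ {X K y} → IsClique G X K → y ∈ X → (∀ {s} → s ∈ K → s ≢ y → Adj G y s) →
                  IsClique G X (K ∪ ⁅ y ⁆)
  clique-insert {X} {K} {y} (K⊆X , K-clique) y∈X y~K = K∪y⊆X , K∪y-clique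
    where
    K∪y⊆X : K ∪ ⁅ y ⁆ ⊆ X
    K∪y⊆X x∈ with ∈-insert⁻ x∈
    ... | inj₁ x∈K = K⊆X x∈K
    ... | inj₂ refl = y∈X
    K∪y-clique : ∀ a b → a ∈ K ∪ ⁅ y ⁆ → b ∈ K ∪ ⁅ y ⁆ → a ≢ b → Adj G a b
    K∪y-clique a b a∈ b∈ a≢b with ∈-insert⁻ a∈ | ∈-insert⁻ b∈
    ... | inj₁ a∈K | inj₁ b∈K = K-clique a b a∈K b∈K a≢b
    ... | inj₁ a∈K | inj₂ refl = Adj-sym (y~K a∈K a≢b)
    ... | inj₂ refl | inj₁ b∈K = y~K b∈K (λ b≡a → a≢b (sym b≡a))
    ... | inj₂ refl | inj₂ refl = ⊥-elim (a≢b refl)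

  clique-singleton : ∀ {X x} → x ∈ X → IsClique G X ⁅ x ⁆
  clique-singleton {x = x} x∈X =
    (λ y∈ → subst (_∈ _) (sym (x∈⁅y⁆⇒x≡y x y∈)) x∈X) ,
    (λ a b a∈ b∈ a≢b → ⊥-elim (a≢b (trans (x∈⁅y⁆⇒x≡y x a∈) (sym (x∈⁅y⁆⇒x≡y x b∈)))))

  absorbed-by-maximal : ∀ {X K y} → IsMaximalClique G X K → y ∈ X →
                        (∀ {s} → s ∈ K → s ≢ y → Adj G y s) → y ∈ K
  absorbed-by-maximal {K = K} (K-clique , maximal) y∈X y~K =
    maximal (K ∪ ⁅ _ ⁆) (clique-insert K-clique y∈X y~K) ∈-insert⁺ˡ ∈-insert⁺ʳ

  meets-clique : ∀ {S K} → IsStrongStable G ⊤ S → IsClique G ⊤ K → Nonempty K →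
                 (∀ y → y ∉ K → ¬ (∀ {x} → x ∈ K → Adj G y x)) → ∃ λ x → x ∈ S × x ∈ K
  meets-clique {K = K} (_ , meets) (K⊆⊤ , K-clique) K≠∅ not-complete =
    meets K ((K⊆⊤ , K-clique) , maximal) K≠∅
    where
    maximal : ∀ K′ → IsClique G ⊤ K′ → K ⊆ K′ → K′ ⊆ K
    maximal K′ (_ , K′-clique) K⊆K′ {y} y∈K′ with y ∈? K
    ... | yes y∈K = y∈K
    ... | no y∉K = ⊥-elim (not-complete y y∉K λ {x} x∈K →
            K′-clique y x y∈K′ (K⊆K′ x∈K) λ { refl → y∉K x∈K })

  meets-edge : ∀ {S a b} → IsStrongStable G ⊤ S → Adj G a b → (∀ c → Adj G c a → Adj G c b → ⊥) →
               a ∈ S ⊎ b ∈ S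
  meets-edge {S} {a} {b} strong ab no-common
    with meets-clique strong (clique-insert (clique-singleton ∈⊤) ∈⊤ b~) (a , ∈-insert⁺ˡ (x∈⁅x⁆ a))
           (λ c c∉ c~ → no-common c (c~ (∈-insert⁺ˡ (x∈⁅x⁆ a))) (c~ ∈-insert⁺ʳ))
    where
    b~ : ∀ {s} → s ∈ ⁅ a ⁆ → s ≢ b → Adj G b s
    b~ s∈ _ rewrite x∈⁅y⁆⇒x≡y a s∈ = Adj-sym ab
  ... | x , x∈S , x∈ with ∈-insert⁻ x∈
  ...   | inj₁ x∈a = inj₁ (subst (_∈ S) (x∈⁅y⁆⇒x≡y a x∈a) x∈S)
  ...   | inj₂ refl = inj₂ x∈S

  meets-triangle : ∀ {S a b c} → IsStrongStable G ⊤ S → Adj G a b → Adj G b c → Adj G a c →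
                   (∀ d → Adj G d a → Adj G d b → Adj G d c → ⊥) → a ∈ S ⊎ b ∈ S ⊎ c ∈ S
  meets-triangle {S} {a} {b} {c} strong ab bc ac no-common
    with meets-clique strong abc-clique (a , a∈)
           (λ d d∉ d~ → no-common d (d~ a∈) (d~ b∈) (d~ ∈-insert⁺ʳ))
    where
    a∈ : a ∈ (⁅ a ⁆ ∪ ⁅ b ⁆) ∪ ⁅ c ⁆
    a∈ = ∈-insert⁺ˡ (∈-insert⁺ˡ (x∈⁅x⁆ a))
    b∈ : b ∈ (⁅ a ⁆ ∪ ⁅ b ⁆) ∪ ⁅ c ⁆
    b∈ = ∈-insert⁺ˡ ∈-insert⁺ʳ
    b~ : ∀ {s} → s ∈ ⁅ a ⁆ → s ≢ b → Adj G b s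
    b~ s∈ _ rewrite x∈⁅y⁆⇒x≡y a s∈ = Adj-sym ab
    c~ : ∀ {s} → s ∈ ⁅ a ⁆ ∪ ⁅ b ⁆ → s ≢ c → Adj G c s
    c~ s∈ _ with ∈-insert⁻ s∈
    ... | inj₁ s∈a rewrite x∈⁅y⁆⇒x≡y a s∈a = Adj-sym ac
    ... | inj₂ refl = Adj-sym bc
    abc-clique : IsClique G ⊤ ((⁅ a ⁆ ∪ ⁅ b ⁆) ∪ ⁅ c ⁆)
    abc-clique = clique-insert (clique-insert (clique-singleton ∈⊤) ∈⊤ b~) ∈⊤ c~
  ... | x , x∈S , x∈ with ∈-insert⁻ x∈
  ...   | inj₂ refl = inj₂ (inj₂ x∈S)
  ...   | inj₁ x∈ab with ∈-insert⁻ x∈ab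
  ...     | inj₂ refl = inj₂ (inj₁ x∈S)
  ...     | inj₁ x∈a = inj₁ (subst (_∈ S) (x∈⁅y⁆⇒x≡y a x∈a) x∈S)

  Dominating : Subset n → Subset n → Set
  Dominating X S = ∀ x → x ∈ X → x ∉ S → ∃ λ y → y ∈ S × Adj G y x

  EdgeDominating : Subset n → Subset n → Set
  EdgeDominating X S = ∀ x z → x ∈ X → z ∈ X → x ∉ S → z ∉ S → Adj G x z →
    ∃ λ y → y ∈ S × Adj G y x × Adj G y z ×
      (∀ d → d ∈ X → d ∉ S → Adj G d x → Adj G d z → Adj G y d)

  -- A maximal clique avoiding S would absorb the dominating vertex of one of its edges
  -- (or of its only vertex).
  strong-if-dominating : ∀ {X S} → IsStable G X S → Dominating X S → EdgeDominating X S →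
                         IsStrongStable G X S
  strong-if-dominating {X} {S} stable dominating edge-dominating = stable , meets
    where
    S⊆X = proj₁ stable
    meets : ∀ K → IsMaximalClique G X K → Nonempty K → ∃ λ x → x ∈ S × x ∈ K
    meets K maximal@((K⊆X , K-clique) , _) (x , x∈K)
      with any? (λ y → (y ∈? S) ×-dec (y ∈? K))
    ... | yes found = found
    ... | no K∩S=∅ with x ∈? S
    ...   | yes x∈S = ⊥-elim (K∩S=∅ (x , x∈S , x∈K))
    ...   | no x∉S with any? (λ z → (z ∈? K) ×-dec ¬? (z ≟ᶠ x))
    ...     | yes (z , z∈K , z≢x)
              with edge-dominating x z (K⊆X x∈K) (K⊆X z∈K) x∉S (λ z∈S → K∩S=∅ (z , z∈S , z∈K))
                     (K-clique x z x∈K z∈K (λ x≡z → z≢x (sym x≡z)))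
    ...       | y , y∈S , yx , yz , y~common =
                ⊥-elim (K∩S=∅ (y , y∈S , absorbed-by-maximal maximal (S⊆X y∈S) y~K))
      where
      y~K : ∀ {s} → s ∈ K → s ≢ y → Adj G y s
      y~K {s} s∈K _ with s ≟ᶠ x | s ≟ᶠ z
      ... | yes refl | _ = yx
      ... | no _ | yes refl = yz
      ... | no s≢x | no s≢z = y~common s (K⊆X s∈K) (λ s∈S → K∩S=∅ (s , s∈S , s∈K))
                                (K-clique s x s∈K x∈K s≢x) (K-clique s z s∈K z∈K s≢z)
    meets K maximal@((K⊆X , _) , _) (x , x∈K) | no K∩S=∅ | no x∉S | no K=x
      with dominating x (K⊆X x∈K) x∉S
    ... | y , y∈S , yx = ⊥-elim (K∩S=∅ (y , y∈S , absorbed-by-maximal maximal (S⊆X y∈S) y~K))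
      where
      y~K : ∀ {s} → s ∈ K → s ≢ y → Adj G y s
      y~K {s} s∈K _ with s ≟ᶠ x
      ... | yes refl = yx
      ... | no s≢x = ⊥-elim (K=x (s , s∈K , s≢x))

  -- A maximal clique K of G - u is maximal in G, unless u is complete to K,
  -- in which case K ∪ {u} is.
  strong-delete : ∀ {S u} → IsStrongStable G ⊤ S → u ∉ S → IsStrongStable G (⊤ - u) S
  strong-delete {S} {u} ((_ , independent) , meets) u∉S =
    ((λ x∈S → x∈p∧x≢y⇒x∈p-y ∈⊤ λ { refl → u∉S x∈S }) , independent) , meets-in-G-u
    where
    meets-in-G-u : ∀ K → IsMaximalClique G (⊤ - u) K → Nonempty K → ∃ λ x → x ∈ S × x ∈ K
    meets-in-G-u K maximal@((K⊆X , K-clique) , _) K≠∅ with all? (λ t → (t ∈? K) →-dec Adj? u t)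
    ... | yes u~K with meets (K ∪ ⁅ u ⁆)
                             (clique-insert (K⊆⊤ , K-clique) ∈⊤ (λ s∈K _ → u~K _ s∈K) , K∪u-maximal)
                             (map₂ ∈-insert⁺ˡ K≠∅)
      where
      K⊆⊤ : K ⊆ ⊤
      K⊆⊤ _ = ∈⊤
      K∪u-maximal : ∀ K′ → IsClique G ⊤ K′ → K ∪ ⁅ u ⁆ ⊆ K′ → K′ ⊆ K ∪ ⁅ u ⁆
      K∪u-maximal K′ (_ , K′-clique) K∪u⊆K′ {t} t∈K′ with t ≟ᶠ u
      ... | yes refl = ∈-insert⁺ʳ
      ... | no t≢u = ∈-insert⁺ˡ (absorbed-by-maximal maximal (x∈p∧x≢y⇒x∈p-y ∈⊤ t≢u)
              λ s∈K s≢t → K′-clique t _ t∈K′ (K∪u⊆K′ (∈-insert⁺ˡ s∈K)) λ t≡s → s≢t (sym t≡s))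
    ...   | x , x∈S , x∈ with ∈-insert⁻ x∈
    ...     | inj₁ x∈K = x , x∈S , x∈K
    ...     | inj₂ refl = ⊥-elim (u∉S x∈S)
    meets-in-G-u K maximal@((K⊆X , K-clique) , _) K≠∅ | no ¬u~K =
      meets K (((λ _ → ∈⊤) , K-clique) , K-maximal) K≠∅
      where
      K-maximal : ∀ K′ → IsClique G ⊤ K′ → K ⊆ K′ → K′ ⊆ K
      K-maximal K′ (_ , K′-clique) K⊆K′ {t} t∈K′ with t ≟ᶠ u
      ... | yes refl = ⊥-elim (¬u~K λ s s∈K →
              K′-clique t s t∈K′ (K⊆K′ s∈K) λ { refl → x∈p-y⇒x≢y (K⊆X s∈K) refl })
      ... | no t≢u = absorbed-by-maximal maximal (x∈p∧x≢y⇒x∈p-y ∈⊤ t≢u)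
              λ s∈K s≢t → K′-clique t _ t∈K′ (K⊆K′ s∈K) λ t≡s → s≢t (sym t≡s)

  not-forced : ∀ {X v} → (∃ λ S → IsStrongStable G X S × v ∈ S) →
               (∃ λ S → IsStrongStable G X S × v ∉ S) → ¬ Forced G X v
  not-forced _ (S′ , strong′ , v∉S′) (inj₁ wanted) = v∉S′ (wanted S′ strong′)
  not-forced (S , strong , v∈S) _ (inj₂ unwanted) = unwanted S strong v∈S

-- Positions on a path

Consecutive : ℕ → ℕ → Set
Consecutive k m = suc k ≡ m ⊎ suc m ≡ k

consecutive-irrefl : ∀ {k} → ¬ Consecutive k k
consecutive-irrefl (inj₁ ())
consecutive-irrefl (inj₂ ())

consecutive-triangle-free : ∀ {k m} → Consecutive k m → Consecutive k (suc m) → ⊥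
consecutive-triangle-free (inj₁ refl) (inj₁ ())
consecutive-triangle-free (inj₁ refl) (inj₂ ())
consecutive-triangle-free (inj₂ refl) (inj₁ ())
consecutive-triangle-free (inj₂ refl) (inj₂ ())

-- Defined by single steps, so that even (suc n) reduces to not (even n).
even : ℕ → Bool
even zero = true
even (suc n) = not (even n)

true≢false : true ≢ false
true≢false ()

<-by-parity : ∀ {m n b} → m ≤ n → even m ≡ b → even n ≡ not b → m < n
<-by-parity m≤n m-parity n-parity = ≤∧≢⇒< m≤n λ { refl → not-¬ m-parity n-parity }

even-or-odd : ∀ m → even m ≡ true ⊎ even m ≡ false
even-or-odd m with even m
... | true = inj₁ refl
... | false = inj₂ refl

even-double : ∀ m → even (m + m) ≡ true
even-double zero = refl
even-double (suc m) rewrite +-suc m m = trans (not-involutive _) (even-double m)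

Even⇒even : ∀ {k} → Even k → even k ≡ true
Even⇒even (m , refl) = even-double m

Odd⇒odd : ∀ {k} → Odd k → even k ≡ false
Odd⇒odd (m , refl) = cong not (even-double m)

even-+-even : ∀ m {n} → even n ≡ true → even (m + n) ≡ even m
even-+-even zero e = e
even-+-even (suc m) e = cong not (even-+-even m e)

even-+-odd : ∀ m {n} → even n ≡ false → even (m + n) ≡ not (even m)
even-+-odd zero e = e
even-+-odd (suc m) e = cong not (even-+-odd m e)

module Alternation (P : ℕ → Set) (M : ℕ)
                   (not-both : ∀ i → suc i ≤ M → P i → P (suc i) → ⊥)
                   (one-of   : ∀ i → suc i ≤ M → P i ⊎ P (suc i)) where

  alternation : ∀ b → (P 0 ⇔ (true ≡ b)) → ∀ i → i ≤ M → P i ⇔ (even i ≡ b)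
  alternation b start zero _ = start
  alternation b start (suc i) i+1≤M = mk⇔ forth back
    where
    previous : P i ⇔ (even i ≡ b)
    previous = alternation b start i (≤-trans (n≤1+n i) i+1≤M)
    forth : P (suc i) → not (even i) ≡ b
    forth p = sym (¬-not λ b≡ → not-both i i+1≤M (Equivalence.from previous (sym b≡)) p)
    back : not (even i) ≡ b → P (suc i)
    back e with one-of i i+1≤M
    ... | inj₂ p = p
    ... | inj₁ p = ⊥-elim (not-¬ refl (trans (Equivalence.to previous p) (sym e)))

Gap : ℕ → Bool → ℕ → Set
Gap q b p = (p < q × even p ≡ b) ⊎ (q < p × even p ≡ not b)

gap? : ∀ q b p → Dec (Gap q b p)
gap? q b p = ((p <? q) ×-dec (even p ≟ᵇ b)) ⊎-dec ((q <? p) ×-dec (even p ≟ᵇ not b))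

gap-≢ : ∀ {q b p} → Gap q b p → p ≢ q
gap-≢ (inj₁ (p<q , _)) refl = <-irrefl refl p<q
gap-≢ (inj₂ (q<p , _)) refl = <-irrefl refl q<p

¬gap-below : ∀ {q b p} → ¬ Gap q b p → p < q → even p ≡ not b
¬gap-below ¬gap p<q = ¬-not λ p≡b → ¬gap (inj₁ (p<q , p≡b))

¬gap-above : ∀ {q b p} → ¬ Gap q b p → q < p → even p ≡ b
¬gap-above {b = b} ¬gap q<p = trans (¬-not λ p≡¬b → ¬gap (inj₂ (q<p , p≡¬b))) (not-involutive b)

gap-independent : ∀ {q b p} → Gap q b p → Gap q b (suc p) → ⊥
gap-independent (inj₁ (_ , p≡b)) (inj₁ (_ , p+1≡b)) = not-¬ refl (trans p≡b (sym p+1≡b))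
gap-independent (inj₂ (_ , p≡¬b)) (inj₂ (_ , p+1≡¬b)) = not-¬ refl (trans p≡¬b (sym p+1≡¬b))
gap-independent (inj₂ (q<p , _)) (inj₁ (p+1<q , _)) = <-asym q<p (<-trans (n<1+n _) p+1<q)
gap-independent (inj₁ (p<q , _)) (inj₂ (q<p+1 , _)) = <-irrefl refl (<-≤-trans p<q (≤-pred q<p+1))

gap-covers : ∀ {q b p} → p ≢ q → suc p ≢ q → ¬ Gap q b p → ¬ Gap q b (suc p) → ⊥
gap-covers {q} {b} {p} p≢q p+1≢q ¬gap ¬gap′ with <-cmp p q
... | tri≈ _ p≡q _ = p≢q p≡q
... | tri> _ _ q<p = not-¬ refl (trans (¬gap-above ¬gap q<p) (sym (¬gap-above ¬gap′ (<-trans q<p (n<1+n p)))))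
... | tri< p<q _ _ with <-cmp (suc p) q
...   | tri≈ _ p+1≡q _ = p+1≢q p+1≡q
...   | tri> _ _ q<p+1 = <-irrefl refl (<-≤-trans p<q (≤-pred q<p+1))
...   | tri< p+1<q _ _ = not-¬ refl (trans (¬gap-below ¬gap p<q) (sym (¬gap-below ¬gap′ p+1<q)))

gap-previous : ∀ {q b k} → ¬ Gap q b (suc k) → suc k < q → Gap q b k
gap-previous ¬gap k+1<q = inj₁ (<-trans (n<1+n _) k+1<q , not-injective (¬gap-below ¬gap k+1<q))

gap-next : ∀ {q b p} → ¬ Gap q b p → q < p → Gap q b (suc p)
gap-next ¬gap q<p = inj₂ (<-trans q<p (n<1+n _) , cong not (¬gap-above ¬gap q<p))


-- Coordinates

-- A graph is handled through coordinates, of which those satisfying Valid name its vertices;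
-- below they are tagged natural numbers, so that index arithmetic never passes through Fin.
module _ {V : Set} (Valid : V → Set) (_⟶_ : V → V → Set) where

  private
    _~_ : V → V → Set
    _~_ = SymClosure _⟶_

  record StrongPattern (InX P : V → Set) : Set where
    field
      inside          : ∀ a → Valid a → P a → InX a
      independent     : ∀ a b → Valid a → Valid b → P a → P b → a ⟶ b → ⊥
      dominating      : ∀ a → Valid a → InX a → ¬ P a → ∃ λ b → Valid b × P b × b ~ a
      edge-dominating : ∀ a c → Valid a → Valid c → InX a → InX c → ¬ P a → ¬ P c → a ⟶ c →
        ∃ λ b → Valid b × P b × b ~ a × b ~ c ×
          (∀ d → Valid d → InX d → ¬ P d → d ~ a → d ~ c → b ~ d)

    independent~ : ∀ a b → Valid a → Valid b → P a → P b → a ~ b → ⊥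
    independent~ a b va vb pa pb (fwd e) = independent a b va vb pa pb e
    independent~ a b va vb pa pb (bwd e) = independent b a vb va pb pa e

    edge-dominating~ : ∀ a c → Valid a → Valid c → InX a → InX c → ¬ P a → ¬ P c → a ~ c →
      ∃ λ b → Valid b × P b × b ~ a × b ~ c ×
        (∀ d → Valid d → InX d → ¬ P d → d ~ a → d ~ c → b ~ d)
    edge-dominating~ a c va vc ia ic ¬pa ¬pc (fwd e) = edge-dominating a c va vc ia ic ¬pa ¬pc e
    edge-dominating~ a c va vc ia ic ¬pa ¬pc (bwd e) with edge-dominating c a vc va ic ia ¬pc ¬pa e
    ... | b , vb , pb , b~c , b~a , b~common =
      b , vb , pb , b~a , b~c , λ d vd id ¬pd d~a d~c → b~common d vd id ¬pd d~c d~a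

  record Coordinatisation {n : ℕ} (G : Graph n) : Set where
    field
      vertex        : V → Fin n
      coord         : Fin n → V
      coord-valid   : ∀ x → Valid (coord x)
      vertex-coord  : ∀ x → vertex (coord x) ≡ x
      coord-vertex  : ∀ {a} → Valid a → coord (vertex a) ≡ a
      edge⇒adjacent : ∀ {a b} → Valid a → Valid b → a ⟶ b → Adj G (vertex a) (vertex b)
      adjacent⇒edge : ∀ {a b} → Valid a → Valid b → Adj G (vertex a) (vertex b) → a ~ b

module InCoordinates {n : ℕ} {G : Graph n} {V : Set} {Valid : V → Set} {_⟶_ : V → V → Set}
                     (𝒞 : Coordinatisation Valid _⟶_ G) where
  open Coordinatisation 𝒞

  private
    _~_ : V → V → Set
    _~_ = SymClosure _⟶_

  ~⇒Adj : ∀ {a b} → Valid a → Valid b → a ~ b → Adj G (vertex a) (vertex b)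
  ~⇒Adj va vb (fwd e) = edge⇒adjacent va vb e
  ~⇒Adj va vb (bwd e) = Adj-sym G (edge⇒adjacent vb va e)

  by-coordinates : (Q : Fin n → Set) → (∀ a → Valid a → Q (vertex a)) → ∀ x → Q x
  by-coordinates Q q x = subst Q (vertex-coord x) (q (coord x) (coord-valid x))

  vertex-injective : ∀ {a b} → Valid a → Valid b → vertex a ≡ vertex b → a ≡ b
  vertex-injective va vb e = trans (sym (coord-vertex va)) (trans (cong coord e) (coord-vertex vb))

  setOf : {P : V → Set} → (∀ a → Dec (P a)) → Subset n
  setOf P? = tabulate (λ x → does (P? (coord x)))

  module _ {P : V → Set} (P? : ∀ a → Dec (P a)) where

    private
      lookup-setOf : ∀ {a} → Valid a → lookup (setOf P?) (vertex a) ≡ does (P? a)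
      lookup-setOf {a} va = trans (lookup∘tabulate _ (vertex a)) (cong (λ b → does (P? b)) (coord-vertex va))

    ∈setOf⁺ : ∀ {a} → Valid a → P a → vertex a ∈ setOf P?
    ∈setOf⁺ {a} va pa = lookup⇒[]= (vertex a) (setOf P?) (trans (lookup-setOf va) (dec-true (P? a) pa))

    ∈setOf⁻ : ∀ {a} → Valid a → vertex a ∈ setOf P? → P a
    ∈setOf⁻ {a} va a∈ with P? a | lookup-setOf va
    ... | yes pa | _ = pa
    ... | no _ | false≡ with trans (sym ([]=⇒lookup a∈)) false≡
    ...   | ()

    ∉setOf⇒¬ : ∀ {a} → Valid a → vertex a ∉ setOf P? → ¬ P a
    ∉setOf⇒¬ va a∉ pa = a∉ (∈setOf⁺ va pa)

    strong-from-pattern : ∀ {X InX} → (∀ {a} → Valid a → vertex a ∈ X ⇔ InX a) →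
                          StrongPattern Valid _⟶_ InX P → IsStrongStable G X (setOf P?)
    strong-from-pattern {X} {InX} X⇔InX 𝒫 =
      strong-if-dominating G (S⊆X , independent′) dominating′ edge-dominating′
      where
      open StrongPattern 𝒫
      S : Subset n
      S = setOf P?
      toX : ∀ {a} → Valid a → InX a → vertex a ∈ X
      toX va = Equivalence.from (X⇔InX va)
      fromX : ∀ {a} → Valid a → vertex a ∈ X → InX a
      fromX va = Equivalence.to (X⇔InX va)
      S⊆X : S ⊆ X
      S⊆X {x} = by-coordinates (λ x → x ∈ S → x ∈ X) (λ a va a∈S → toX va (inside a va (∈setOf⁻ va a∈S))) x
      independent′ : ∀ x y → x ∈ S → y ∈ S → ¬ Adj G x y
      independent′ = by-coordinates _ λ a va → by-coordinates _ λ b vb a∈S b∈S ab →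
        independent~ a b va vb (∈setOf⁻ va a∈S) (∈setOf⁻ vb b∈S) (adjacent⇒edge va vb ab)
      dominating′ : Dominating G X S
      dominating′ = by-coordinates _ λ a va a∈X a∉S →
        let (b , vb , pb , b~a) = dominating a va (fromX va a∈X) (∉setOf⇒¬ va a∉S)
        in vertex b , ∈setOf⁺ vb pb , ~⇒Adj vb va b~a
      edge-dominating′ : EdgeDominating G X S
      edge-dominating′ = by-coordinates _ λ a va → by-coordinates _ λ c vc a∈X c∈X a∉S c∉S ac →
        let (b , vb , pb , b~a , b~c , b~common) =
              edge-dominating~ a c va vc (fromX va a∈X) (fromX vc c∈X) (∉setOf⇒¬ va a∉S) (∉setOf⇒¬ vc c∉S)
                               (adjacent⇒edge va vc ac)
        in vertex b , ∈setOf⁺ vb pb , ~⇒Adj vb va b~a , ~⇒Adj vb vc b~c ,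
           by-coordinates _ λ d vd d∈X d∉S da dc →
             ~⇒Adj vb vd (b~common d vd (fromX vd d∈X) (∉setOf⇒¬ vd d∉S)
                            (adjacent⇒edge vd va da) (adjacent⇒edge vd vc dc))

  module _ {P : V → Set} (P? : ∀ a → Dec (P a)) where

    strong-in-G : StrongPattern Valid _⟶_ (λ _ → Unit) P → IsStrongStable G ⊤ (setOf P?)
    strong-in-G = strong-from-pattern P? λ _ → mk⇔ (λ _ → tt) (λ _ → ∈⊤)

    strong-in-G-minus : ∀ {r InX} → Valid r → (∀ {a} → Valid a → a ≢ r ⇔ InX a) →
                        StrongPattern Valid _⟶_ InX P → IsStrongStable G (⊤ - vertex r) (setOf P?)
    strong-in-G-minus {r} vr ≢r⇔InX = strong-from-pattern P? λ va → mk⇔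
      (λ a∈ → Equivalence.to (≢r⇔InX va) λ a≡r → x∈p-y⇒x≢y a∈ (cong vertex a≡r))
      (λ InXa → x∈p∧x≢y⇒x∈p-y ∈⊤ λ e → Equivalence.from (≢r⇔InX va) InXa (vertex-injective va vr e))

  module _ {X S : Subset n} (strong : IsStrongStable G X S) where

    independent-at : ∀ {a b} → Valid a → Valid b → vertex a ∈ S → vertex b ∈ S → a ~ b → ⊥
    independent-at va vb a∈S b∈S a~b = proj₂ (proj₁ strong) _ _ a∈S b∈S (~⇒Adj va vb a~b)

  module _ {S : Subset n} (strong : IsStrongStable G ⊤ S) where

    meets-edge-at : ∀ {a b} → Valid a → Valid b → a ~ b →
                    (∀ c → Valid c → c ~ a → c ~ b → ⊥) → vertex a ∈ S ⊎ vertex b ∈ S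
    meets-edge-at va vb a~b no-common = meets-edge G strong (~⇒Adj va vb a~b)
      (by-coordinates _ λ c vc ca cb → no-common c vc (adjacent⇒edge vc va ca) (adjacent⇒edge vc vb cb))

    meets-triangle-at : ∀ {a b c} → Valid a → Valid b → Valid c → a ~ b → b ~ c → a ~ c →
                        (∀ d → Valid d → d ~ a → d ~ b → d ~ c → ⊥) →
                        vertex a ∈ S ⊎ vertex b ∈ S ⊎ vertex c ∈ S
    meets-triangle-at va vb vc a~b b~c a~c no-common =
      meets-triangle G strong (~⇒Adj va vb a~b) (~⇒Adj vb vc b~c) (~⇒Adj va vc a~c)
        (by-coordinates _ λ d vd da db dc →
          no-common d vd (adjacent⇒edge vd va da) (adjacent⇒edge vd vb db) (adjacent⇒edge vd vc dc))

record Coding (L : Set) (E : L → L → Set) {V : Set} (Valid : V → Set) (_⟶_ : V → V → Set) : Set where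
  field
    encode        : L → V
    decode        : V → L
    encode-valid  : ∀ a → Valid (encode a)
    decode-encode : ∀ a → decode (encode a) ≡ a
    encode-decode : ∀ {x} → Valid x → encode (decode x) ≡ x
    encode-edge   : ∀ {a b} → E a b → SymClosure _⟶_ (encode a) (encode b)
    decode-edge   : ∀ {x y} → Valid x → Valid y → x ⟶ y → E (decode x) (decode y) ⊎ E (decode y) (decode x)

coordinatise : ∀ {n} {G : Graph n} {v L E h V} {Valid : V → Set} {_⟶_ : V → V → Set} →
               IsoToModel G v L E h → (𝒟 : Coding L E Valid _⟶_) →
               ∃ λ (𝒞 : Coordinatisation Valid _⟶_ G) →
                 Coordinatisation.vertex 𝒞 (Coding.encode 𝒟 h) ≡ v
coordinatise {n} {G} {L = L} {h = h} {V = V} {Valid} {_⟶_}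
             (f , f-injective , f-surjective , fh≡v , f-adj) 𝒟 =
  record
    { vertex        = vertex
    ; coord         = coord
    ; coord-valid   = λ x → encode-valid (f⁻¹ x)
    ; vertex-coord  = λ x → trans (cong f (decode-encode (f⁻¹ x))) (proj₂ (f-surjective x))
    ; coord-vertex  = λ {a} va → trans (cong encode (f⁻¹∘f (decode a))) (encode-decode va)
    ; edge⇒adjacent = λ va vb e → proj₂ (f-adj _ _) (decode-edge va vb e)
    ; adjacent⇒edge = adjacent⇒edge
    }
  , trans (cong f (decode-encode h)) fh≡v
  where
  open Coding 𝒟
  f⁻¹ : Fin n → L
  f⁻¹ x = proj₁ (f-surjective x)
  f⁻¹∘f : ∀ l → f⁻¹ (f l) ≡ l
  f⁻¹∘f l = f-injective _ _ (proj₂ (f-surjective (f l)))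
  vertex : V → Fin n
  vertex a = f (decode a)
  coord : Fin n → V
  coord x = encode (f⁻¹ x)
  adjacent⇒edge : ∀ {a b} → Valid a → Valid b → Adj G (vertex a) (vertex b) → SymClosure _⟶_ a b
  adjacent⇒edge {a} {b} va vb ab with proj₁ (f-adj (decode a) (decode b)) ab
  ... | inj₁ e = subst₂ (SymClosure _⟶_) (encode-decode va) (encode-decode vb) (encode-edge e)
  ... | inj₂ e = subst₂ (SymClosure _⟶_) (encode-decode va) (encode-decode vb)
                   (~-symmetric _⟶_ (encode-edge e))

-- Pupas and larvas

-- On the path v - p_1 - ... - p_t - c_1, path p is the vertex at distance p from v (so c_1 is
-- path (t + 1)); the rest of the hole c_2, ..., c_k is hole 0, ..., hole K2 with K2 = k - 2.
data PupaPoint : Set where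
  path : ℕ → PupaPoint
  hole : ℕ → PupaPoint

module PupaModel (K2 t : ℕ) (2≤K2 : 2 ≤ K2) (K2-even : even K2 ≡ true) (t-even : even t ≡ true) where

  T1 : ℕ
  T1 = suc t

  Valid : PupaPoint → Set
  Valid (path p) = p ≤ T1
  Valid (hole m) = m ≤ K2

  data _⟶_ : PupaPoint → PupaPoint → Set where
    path-step : ∀ p → path p ⟶ path (suc p)
    hole-step : ∀ m → hole m ⟶ hole (suc m)
    hub       : ∀ p → hole 0 ⟶ path p
    wrap      : ∀ {m p} → m ≡ K2 → p ≡ T1 → hole m ⟶ path p

  infix 4 _~_
  _~_ : PupaPoint → PupaPoint → Set
  _~_ = SymClosure _⟶_

  path~path : ∀ {p p′} → path p ~ path p′ → Consecutive p p′
  path~path (fwd (path-step _)) = inj₁ refl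
  path~path (bwd (path-step _)) = inj₂ refl

  hole~hole : ∀ {m m′} → hole m ~ hole m′ → Consecutive m m′
  hole~hole (fwd (hole-step _)) = inj₁ refl
  hole~hole (bwd (hole-step _)) = inj₂ refl

  hole~path : ∀ {m p} → hole m ~ path p → m ≡ 0 ⊎ (m ≡ K2 × p ≡ T1)
  hole~path (fwd (hub _)) = inj₁ refl
  hole~path (fwd (wrap m≡K2 p≡T1)) = inj₂ (m≡K2 , p≡T1)

  path~hole : ∀ {p m} → path p ~ hole m → m ≡ 0 ⊎ (m ≡ K2 × p ≡ T1)
  path~hole (bwd e) = hole~path (fwd e)

  T1-odd : even T1 ≡ false
  T1-odd = cong not t-even

  K2≢0 : K2 ≢ 0
  K2≢0 K2≡0 with subst (2 ≤_) K2≡0 2≤K2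
  ... | ()

  K2≢1 : K2 ≢ 1
  K2≢1 K2≡1 with subst (2 ≤_) K2≡1 2≤K2
  ... | s≤s ()

  ~-irrefl : ∀ {a} → ¬ a ~ a
  ~-irrefl {path _} a~a = consecutive-irrefl (path~path a~a)
  ~-irrefl {hole _} a~a = consecutive-irrefl (hole~hole a~a)

  wrap-maximal : ∀ d → d ~ hole K2 → d ~ path T1 → ⊥
  wrap-maximal (path _) d~K2 d~T1 with path~hole d~K2
  ... | inj₁ K2≡0 = K2≢0 K2≡0
  ... | inj₂ (_ , refl) = ~-irrefl d~T1
  wrap-maximal (hole _) d~K2 d~T1 with hole~path d~T1
  ... | inj₂ (refl , _) = ~-irrefl d~K2
  ... | inj₁ refl with hole~hole d~K2
  ...   | inj₁ 1≡K2 = K2≢1 (sym 1≡K2)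
  ...   | inj₂ ()

  hole-step-maximal : ∀ {i} d → d ~ hole i → d ~ hole (suc i) → ⊥
  hole-step-maximal (hole _) d~i d~i+1 = consecutive-triangle-free (hole~hole d~i) (hole~hole d~i+1)
  hole-step-maximal (path _) d~i d~i+1 with path~hole d~i | path~hole d~i+1
  ... | _ | inj₁ ()
  ... | inj₁ refl | inj₂ (1≡K2 , _) = K2≢1 (sym 1≡K2)
  ... | inj₂ (refl , _) | inj₂ (i+1≡i , _) = 1+n≢n i+1≡i

  path-triangle-maximal : ∀ {i} d → d ~ path i → d ~ path (suc i) → d ~ hole 0 → ⊥
  path-triangle-maximal (path _) d~i d~i+1 _ = consecutive-triangle-free (path~path d~i) (path~path d~i+1)
  path-triangle-maximal (hole _) d~i d~i+1 d~hub with hole~path d~i | hole~path d~i+1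
  ... | inj₁ refl | _ = ~-irrefl d~hub
  ... | inj₂ (_ , i≡T1) | inj₂ (_ , i+1≡T1) = 1+n≢n (trans i+1≡T1 (sym i≡T1))
  ... | inj₂ (m≡K2 , _) | inj₁ m≡0 = K2≢0 (trans (sym m≡K2) m≡0)

  hub-common-neighbour : ∀ {d p} → d ~ hole 0 → d ~ path p → ∃ λ p′ → d ≡ path p′ × Consecutive p′ p
  hub-common-neighbour {path p′} _ d~p = p′ , refl , path~path d~p
  hub-common-neighbour {hole _} d~hub d~p with hole~hole d~hub | hole~path d~p
  ... | inj₁ () | _
  ... | inj₂ refl | inj₁ ()
  ... | inj₂ refl | inj₂ (1≡K2 , _) = ⊥-elim (K2≢1 (sym 1≡K2))

  EvenHole : PupaPoint → Set
  EvenHole (path _) = ⊥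
  EvenHole (hole m) = even m ≡ true

  even-hole? : ∀ a → Dec (EvenHole a)
  even-hole? (path _) = no λ ()
  even-hole? (hole m) = even m ≟ᵇ true

  even-hole-pattern : StrongPattern Valid _⟶_ (λ _ → Unit) EvenHole
  even-hole-pattern = record
    { inside          = λ _ _ _ → tt
    ; independent     = independent
    ; dominating      = dominating
    ; edge-dominating = edge-dominating
    }
    where
    independent : ∀ a b → Valid a → Valid b → EvenHole a → EvenHole b → a ⟶ b → ⊥
    independent (hole m) (hole _) _ _ m-even m+1-even (hole-step _) =
      true≢false (trans (sym m+1-even) (cong not m-even))
    dominating : ∀ a → Valid a → Unit → ¬ EvenHole a → ∃ λ b → Valid b × EvenHole b × b ~ a
    dominating (path p) _ _ _ = hole 0 , z≤n , refl , fwd (hub p)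
    dominating (hole m) m≤K2 _ m-odd = hole (suc m) , m<K2 , cong not (¬-not m-odd) , bwd (hole-step m)
      where
      m<K2 : m < K2
      m<K2 = <-by-parity m≤K2 (¬-not m-odd) K2-even
    edge-dominating : ∀ a c → Valid a → Valid c → Unit → Unit → ¬ EvenHole a → ¬ EvenHole c → a ⟶ c →
      ∃ λ b → Valid b × EvenHole b × b ~ a × b ~ c ×
        (∀ d → Valid d → Unit → ¬ EvenHole d → d ~ a → d ~ c → b ~ d)
    edge-dominating (path p) _ _ _ _ _ _ _ (path-step _) =
      hole 0 , z≤n , refl , fwd (hub p) , fwd (hub (suc p)) , no-common
      where
      no-common : ∀ d → Valid d → Unit → ¬ EvenHole d → d ~ path p → d ~ path (suc p) → hole 0 ~ d
      no-common (path _) _ _ _ d~p d~p+1 = ⊥-elim (consecutive-triangle-free (path~path d~p) (path~path d~p+1))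
      no-common (hole m) _ _ m-odd d~p _ with hole~path d~p
      ... | inj₁ refl = ⊥-elim (m-odd refl)
      ... | inj₂ (refl , _) = ⊥-elim (m-odd K2-even)
    edge-dominating (hole m) _ _ _ _ _ m-odd m+1-odd (hole-step _) = ⊥-elim (m+1-odd (cong not (¬-not m-odd)))
    edge-dominating _ _ _ _ _ _ hub-odd _ (hub _) = ⊥-elim (hub-odd refl)
    edge-dominating _ _ _ _ _ _ K2-odd _ (wrap refl _) = ⊥-elim (K2-odd K2-even)

  OddIndexed : PupaPoint → Set
  OddIndexed (path p) = even p ≡ false
  OddIndexed (hole m) = even m ≡ false

  odd-indexed? : ∀ a → Dec (OddIndexed a)
  odd-indexed? (path p) = even p ≟ᵇ false
  odd-indexed? (hole m) = even m ≟ᵇ false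

  even-hole-not-odd-indexed : ∀ a → EvenHole a → ¬ OddIndexed a
  even-hole-not-odd-indexed (hole _) even odd = true≢false (trans (sym even) odd)

  odd-indexed-pattern : StrongPattern Valid _⟶_ (λ _ → Unit) OddIndexed
  odd-indexed-pattern = record
    { inside          = λ _ _ _ → tt
    ; independent     = independent
    ; dominating      = dominating
    ; edge-dominating = edge-dominating
    }
    where
    successor-odd : ∀ k → ¬ even k ≡ false → even (suc k) ≡ false
    successor-odd k k-even = cong not (¬-not k-even)
    independent : ∀ a b → Valid a → Valid b → OddIndexed a → OddIndexed b → a ⟶ b → ⊥
    independent _ _ _ _ p-odd p+1-odd (path-step _) = true≢false (trans (sym (cong not p-odd)) p+1-odd)
    independent _ _ _ _ m-odd m+1-odd (hole-step _) = true≢false (trans (sym (cong not m-odd)) m+1-odd)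
    independent _ _ _ _ () _ (hub _)
    independent _ _ _ _ K2-odd _ (wrap refl _) = true≢false (trans (sym K2-even) K2-odd)
    dominating : ∀ a → Valid a → Unit → ¬ OddIndexed a → ∃ λ b → Valid b × OddIndexed b × b ~ a
    dominating (path p) p≤T1 _ p-even = path (suc p) , p<T1 , successor-odd p p-even , bwd (path-step p)
      where
      p<T1 : p < T1
      p<T1 = <-by-parity p≤T1 (¬-not p-even) T1-odd
    dominating (hole zero) _ _ _ = hole 1 , ≤-trans (s≤s z≤n) 2≤K2 , refl , bwd (hole-step 0)
    dominating (hole (suc m)) m+1≤K2 _ m+1-even =
      hole m , <⇒≤ m+1≤K2 , not-injective (¬-not m+1-even) , fwd (hole-step m)
    edge-dominating : ∀ a c → Valid a → Valid c → Unit → Unit → ¬ OddIndexed a → ¬ OddIndexed c → a ⟶ c →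
      ∃ λ b → Valid b × OddIndexed b × b ~ a × b ~ c ×
        (∀ d → Valid d → Unit → ¬ OddIndexed d → d ~ a → d ~ c → b ~ d)
    edge-dominating _ _ _ _ _ _ p-even p+1-even (path-step p) = ⊥-elim (p+1-even (successor-odd p p-even))
    edge-dominating _ _ _ _ _ _ m-even m+1-even (hole-step m) = ⊥-elim (m+1-even (successor-odd m m-even))
    edge-dominating _ _ _ _ _ _ _ T1-even (wrap _ refl) = ⊥-elim (T1-even T1-odd)
    edge-dominating _ (path p) _ p≤T1 _ _ _ p-even (hub _) =
      path (suc p) , p<T1 , successor-odd p p-even , bwd (hub (suc p)) , bwd (path-step p) , no-common
      where
      p<T1 : p < T1
      p<T1 = <-by-parity p≤T1 (¬-not p-even) T1-odd
      no-common : ∀ d → Valid d → Unit → ¬ OddIndexed d → d ~ hole 0 → d ~ path p → path (suc p) ~ d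
      no-common d _ _ d-even d~hub d~p with hub-common-neighbour d~hub d~p
      ... | p′ , refl , inj₁ refl = ⊥-elim (p-even (successor-odd p′ d-even))
      ... | p′ , refl , inj₂ refl = ⊥-elim (d-even (successor-odd p p-even))

  module _ (q J : ℕ) where

    Uncut : PupaPoint → Set
    Uncut (path p) = p ≢ q
    Uncut (hole m) = m ≢ J

    Gapped : PupaPoint → Set
    Gapped (path p) = Gap q true p
    Gapped (hole m) = Gap J false m

    gapped? : ∀ a → Dec (Gapped a)
    gapped? (path p) = gap? q true p
    gapped? (hole m) = gap? J false m

  CutAt : ℕ → ℕ → Set
  CutAt q J = (q ≤ T1 × J ≡ suc K2) ⊎ (q ≡ suc T1 × J ≤ K2)

  -- Deleting a vertex r ≠ v cuts the path at q or the hole at J; the other index is out of range.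
  cut : ∀ r → Valid r → r ≢ path 0 →
        ∃ λ q → ∃ λ J → 1 ≤ q × CutAt q J × (∀ {a} → Valid a → (a ≢ r) ⇔ Uncut q J a)
  cut (path zero) _ r≢head = ⊥-elim (r≢head refl)
  cut (path (suc p)) p<T1 _ = suc p , suc K2 , s≤s z≤n , inj₁ (p<T1 , refl) , uncut-path
    where
    uncut-path : ∀ {a} → Valid a → (a ≢ path (suc p)) ⇔ Uncut (suc p) (suc K2) a
    uncut-path {path _} _ = mk⇔ (λ ne e → ne (cong path e)) (λ ne → λ { refl → ne refl })
    uncut-path {hole _} m≤K2 = mk⇔ (λ _ m≡ → <-irrefl m≡ (s≤s m≤K2)) (λ _ ())
  cut (hole J) J≤K2 _ = suc T1 , J , s≤s z≤n , inj₂ (refl , J≤K2) , uncut-hole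
    where
    uncut-hole : ∀ {a} → Valid a → (a ≢ hole J) ⇔ Uncut (suc T1) J a
    uncut-hole {path _} p≤T1 = mk⇔ (λ _ p≡ → <-irrefl p≡ (s≤s p≤T1)) (λ _ ())
    uncut-hole {hole _} _ = mk⇔ (λ ne e → ne (cong hole e)) (λ ne → λ { refl → ne refl })

  module _ {q J : ℕ} (1≤q : 1 ≤ q) (cut : CutAt q J) where

    private
      J≤K2⇒q≡T1+1 : J ≤ K2 → q ≡ suc T1
      J≤K2⇒q≡T1+1 J≤K2 = [ (λ (_ , J≡K2+1) → ⊥-elim (<-irrefl J≡K2+1 (s≤s J≤K2))) , proj₁ ]′ cut

      K2<J⇒q≤T1 : K2 < J → q ≤ T1
      K2<J⇒q≤T1 K2<J = [ proj₁ , (λ (_ , J≤K2) → ⊥-elim (<-irrefl refl (<-≤-trans K2<J J≤K2))) ]′ cut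

      no-common-at-hub : ∀ {p} → Uncut q J (path p) → ¬ Gapped q J (path p) →
                         ∀ d → Uncut q J d → ¬ Gapped q J d → d ~ hole 0 → d ~ path p → ⊥
      no-common-at-hub p≢q ¬gap d d≢ ¬gap′ d~hub d~p with hub-common-neighbour d~hub d~p
      ... | _ , refl , inj₁ refl = gap-covers d≢ p≢q ¬gap′ ¬gap
      ... | _ , refl , inj₂ refl = gap-covers p≢q d≢ ¬gap ¬gap′

    gapped-pattern : StrongPattern Valid _⟶_ (Uncut q J) (Gapped q J)
    gapped-pattern = record
      { inside          = inside
      ; independent     = independent
      ; dominating      = dominating
      ; edge-dominating = edge-dominating
      }
      where
      inside : ∀ a → Valid a → Gapped q J a → Uncut q J a
      inside (path _) _ = gap-≢
      inside (hole _) _ = gap-≢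
      independent : ∀ a b → Valid a → Valid b → Gapped q J a → Gapped q J b → a ⟶ b → ⊥
      independent _ _ _ _ gap gap′ (path-step _) = gap-independent gap gap′
      independent _ _ _ _ gap gap′ (hole-step _) = gap-independent gap gap′
      independent _ _ _ _ (inj₁ (_ , ())) _ (hub _)
      independent _ _ _ _ (inj₁ (_ , K2-odd)) _ (wrap refl refl) = true≢false (trans (sym K2-even) K2-odd)
      independent _ _ _ _ (inj₂ (J<K2 , _)) path-gap (wrap refl refl) with path-gap | J≤K2⇒q≡T1+1 (<⇒≤ J<K2)
      ... | inj₁ (_ , T1-even) | _ = true≢false (trans (sym T1-even) T1-odd)
      ... | inj₂ (q<T1 , _) | refl = <-asym q<T1 (n<1+n T1)
      dominating : ∀ a → Valid a → Uncut q J a → ¬ Gapped q J a → ∃ λ b → Valid b × Gapped q J b × b ~ a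
      dominating (path zero) _ _ ¬gap = ⊥-elim (¬gap (inj₁ (1≤q , refl)))
      dominating (path (suc k)) p≤T1 p≢q ¬gap with <-cmp (suc k) q
      ... | tri≈ _ p≡q _ = ⊥-elim (p≢q p≡q)
      ... | tri< p<q _ _ = path k , <⇒≤ p≤T1 , gap-previous ¬gap p<q , fwd (path-step k)
      ... | tri> _ _ q<p = path (suc (suc k)) , p<T1 , gap-next ¬gap q<p , bwd (path-step (suc k))
        where
        p<T1 : suc k < T1
        p<T1 = <-by-parity p≤T1 (¬gap-above ¬gap q<p) T1-odd
      dominating (hole zero) _ _ _ = path 0 , z≤n , inj₁ (1≤q , refl) , bwd (hub 0)
      dominating (hole (suc k)) m≤K2 m≢J ¬gap with <-cmp (suc k) J
      ... | tri≈ _ m≡J _ = ⊥-elim (m≢J m≡J)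
      ... | tri< m<J _ _ = hole k , <⇒≤ m≤K2 , gap-previous ¬gap m<J , fwd (hole-step k)
      ... | tri> _ _ J<m = hole (suc (suc k)) , m<K2 , gap-next ¬gap J<m , bwd (hole-step (suc k))
        where
        m<K2 : suc k < K2
        m<K2 = <-by-parity m≤K2 (¬gap-above ¬gap J<m) K2-even
      edge-dominating : ∀ a c → Valid a → Valid c → Uncut q J a → Uncut q J c →
        ¬ Gapped q J a → ¬ Gapped q J c → a ⟶ c →
        ∃ λ b → Valid b × Gapped q J b × b ~ a × b ~ c ×
          (∀ d → Valid d → Uncut q J d → ¬ Gapped q J d → d ~ a → d ~ c → b ~ d)
      edge-dominating _ _ _ _ p≢q p+1≢q ¬gap ¬gap′ (path-step _) = ⊥-elim (gap-covers p≢q p+1≢q ¬gap ¬gap′)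
      edge-dominating _ _ _ _ m≢J m+1≢J ¬gap ¬gap′ (hole-step _) = ⊥-elim (gap-covers m≢J m+1≢J ¬gap ¬gap′)
      edge-dominating _ _ _ _ K2≢J T1≢q ¬gap ¬gap′ (wrap refl refl) with <-cmp K2 J
      ... | tri≈ _ K2≡J _ = ⊥-elim (K2≢J K2≡J)
      ... | tri> _ _ J<K2 = ⊥-elim (true≢false (trans (sym K2-even) (¬gap-above ¬gap J<K2)))
      ... | tri< K2<J _ _ = ⊥-elim (true≢false (trans (sym (¬gap-above ¬gap′ q<T1)) T1-odd))
        where
        q<T1 : q < T1
        q<T1 = ≤∧≢⇒< (K2<J⇒q≤T1 K2<J) λ q≡T1 → T1≢q (sym q≡T1)
      edge-dominating _ (path zero) _ _ _ _ _ ¬gap (hub _) = ⊥-elim (¬gap (inj₁ (1≤q , refl)))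
      edge-dominating _ (path (suc k)) _ p≤T1 _ p≢q _ ¬gap (hub _) with <-cmp (suc k) q
      ... | tri≈ _ p≡q _ = ⊥-elim (p≢q p≡q)
      ... | tri< p<q _ _ = path k , <⇒≤ p≤T1 , gap-previous ¬gap p<q , bwd (hub k) , fwd (path-step k) ,
                           λ d _ d≢ ¬gap′ d~hub d~p → ⊥-elim (no-common-at-hub p≢q ¬gap d d≢ ¬gap′ d~hub d~p)
      ... | tri> _ _ q<p = path (suc (suc k)) , p<T1 , gap-next ¬gap q<p , bwd (hub _) , bwd (path-step (suc k)) ,
                           λ d _ d≢ ¬gap′ d~hub d~p → ⊥-elim (no-common-at-hub p≢q ¬gap d d≢ ¬gap′ d~hub d~p)
        where
        p<T1 : suc k < T1
        p<T1 = <-by-parity p≤T1 (¬gap-above ¬gap q<p) T1-odd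

  k : ℕ
  k = suc (suc K2)

  encode-cycle : ℕ → PupaPoint
  encode-cycle zero = path T1
  encode-cycle (suc m) = hole m

  encode : PupaLabel k t → PupaPoint
  encode head = path 0
  encode (pth i) = path (suc (toℕ i))
  encode (cyc i) = encode-cycle (toℕ i)

  decode-path : ℕ → PupaLabel k t
  decode-path p with p <? t
  ... | yes p<t = pth (fromℕ< p<t)
  ... | no _ = cyc fzero

  decode : PupaPoint → PupaLabel k t
  decode (path zero) = head
  decode (path (suc p)) = decode-path p
  decode (hole m) = cyc (suc m mod k)

  toℕ-cycle : ∀ {m} → m ≤ K2 → toℕ (suc m mod k) ≡ suc m
  toℕ-cycle m≤K2 = trans (toℕ-fromℕ< _) (m≤n⇒m%n≡m (s≤s m≤K2))

  decode-T1 : decode (path T1) ≡ cyc fzero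
  decode-T1 with t <? t
  ... | yes t<t = ⊥-elim (<-irrefl refl t<t)
  ... | no _ = refl

  encode-valid : ∀ a → Valid (encode a)
  encode-valid head = z≤n
  encode-valid (pth i) = s≤s (<⇒≤ (toℕ<n i))
  encode-valid (cyc i) = valid-cycle (toℕ i) (toℕ<n i)
    where
    valid-cycle : ∀ m → m < k → Valid (encode-cycle m)
    valid-cycle zero _ = ≤-refl
    valid-cycle (suc m) m<k = ≤-pred (≤-pred m<k)

  decode-encode : ∀ a → decode (encode a) ≡ a
  decode-encode head = refl
  decode-encode (pth i) with toℕ i <? t
  ... | yes i<t = cong pth (fromℕ<-toℕ i i<t)
  ... | no i≮t = ⊥-elim (i≮t (toℕ<n i))
  decode-encode (cyc i) = decode-encode-cycle (toℕ i) refl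
    where
    decode-encode-cycle : ∀ m → toℕ i ≡ m → decode (encode-cycle m) ≡ cyc i
    decode-encode-cycle zero i≡0 = trans decode-T1 (cong cyc (toℕ-injective (sym i≡0)))
    decode-encode-cycle (suc m) i≡m+1 = cong cyc (toℕ-injective (trans (toℕ-cycle m≤K2) (sym i≡m+1)))
      where
      m≤K2 : m ≤ K2
      m≤K2 = ≤-pred (≤-pred (subst (_< k) i≡m+1 (toℕ<n i)))

  encode-decode : ∀ {x} → Valid x → encode (decode x) ≡ x
  encode-decode {path zero} _ = refl
  encode-decode {path (suc p)} p<T1 with p <? t
  ... | yes p<t = cong (λ p′ → path (suc p′)) (toℕ-fromℕ< p<t)
  ... | no p≮t = cong (λ p′ → path (suc p′)) (≤-antisym (≮⇒≥ p≮t) (≤-pred p<T1))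
  encode-decode {hole m} m≤K2 rewrite toℕ-cycle m≤K2 = refl

  encode-on-path : ∀ a {x} → pupaPos a ≡ just x → encode a ≡ path x
  encode-on-path head refl = refl
  encode-on-path (pth _) refl = refl
  encode-on-path (cyc i) pos with toℕ i
  encode-on-path (cyc i) refl | zero = refl

  on-path-encode : ∀ a {x} → encode a ≡ path x → pupaPos a ≡ just x
  on-path-encode head refl = refl
  on-path-encode (pth _) refl = refl
  on-path-encode (cyc i) e with toℕ i
  on-path-encode (cyc i) refl | zero = refl

  pos-decode : ∀ {p} → p ≤ T1 → pupaPos (decode (path p)) ≡ just p
  pos-decode {p} p≤T1 = on-path-encode (decode (path p)) (encode-decode p≤T1)

  encode-edge : ∀ {a b} → PupaEdge k t a b → encode a ~ encode b
  encode-edge (inj₁ (i , j , refl , refl , i→j)) = cycle-edge i→j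
    where
    cycle-edge : ∀ {x y} → suc x ≡ y ⊎ (suc x ≡ k × y ≡ 0) → encode-cycle x ~ encode-cycle y
    cycle-edge {zero} (inj₁ refl) = bwd (hub T1)
    cycle-edge {suc m} (inj₁ refl) = fwd (hole-step m)
    cycle-edge (inj₂ (x+1≡k , refl)) rewrite suc-injective x+1≡k = fwd (wrap refl refl)
  encode-edge {a} {b} (inj₂ (inj₁ (x , pos-a , pos-b))) =
    subst₂ _~_ (sym (encode-on-path a pos-a)) (sym (encode-on-path b pos-b)) (fwd (path-step x))
  encode-edge {b = b} (inj₂ (inj₂ (i , refl , i≡1 , x , pos-b))) =
    subst₂ _~_ (cong encode-cycle (sym i≡1)) (sym (encode-on-path b pos-b)) (fwd (hub x))

  decode-edge : ∀ {x y} → Valid x → Valid y → x ⟶ y →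
                PupaEdge k t (decode x) (decode y) ⊎ PupaEdge k t (decode y) (decode x)
  decode-edge p≤T1 p+1≤T1 (path-step p) = inj₁ (inj₂ (inj₁ (p , pos-decode p≤T1 , pos-decode p+1≤T1)))
  decode-edge m≤K2 m+1≤K2 (hole-step m) =
    inj₁ (inj₁ (_ , _ , refl , refl , inj₁ (trans (cong suc (toℕ-cycle m≤K2)) (sym (toℕ-cycle m+1≤K2)))))
  decode-edge _ p≤T1 (hub p) = inj₁ (inj₂ (inj₂ (_ , refl , toℕ-cycle z≤n , p , pos-decode p≤T1)))
  decode-edge _ _ (wrap refl refl) rewrite decode-T1 =
    inj₁ (inj₁ (_ , _ , refl , refl , inj₂ (cong suc (toℕ-cycle ≤-refl) , refl)))

  pupa-coding : Coding (PupaLabel k t) (PupaEdge k t) Valid _⟶_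
  pupa-coding = record
    { encode        = encode
    ; decode        = decode
    ; encode-valid  = encode-valid
    ; decode-encode = decode-encode
    ; encode-decode = encode-decode
    ; encode-edge   = encode-edge
    ; decode-edge   = decode-edge
    }

  module InPupa {n : ℕ} {G : Graph n} (𝒞 : Coordinatisation Valid _⟶_ G) where
    open Coordinatisation 𝒞
    open InCoordinates 𝒞

    head-unwanted : Unwanted G ⊤ (vertex (path 0))
    head-unwanted S strong head∈S =
      [ hole-K2∉S , path-T1∉S ]′ (meets-edge-at strong ≤-refl ≤-refl (fwd (wrap refl refl)) λ d _ → wrap-maximal d)
      where
      hub∉S : vertex (hole 0) ∉ S
      hub∉S hub∈S = independent-at strong z≤n z≤n hub∈S head∈S (fwd (hub 0))

      path-T1∉S : vertex (path T1) ∉ S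
      path-T1∉S T1∈S = true≢false (trans (sym (Equivalence.to path-pattern T1∈S)) T1-odd)
        where
        not-both : ∀ i → suc i ≤ T1 → vertex (path i) ∈ S → vertex (path (suc i)) ∈ S → ⊥
        not-both i i<T1 i∈S i+1∈S = independent-at strong (<⇒≤ i<T1) i<T1 i∈S i+1∈S (fwd (path-step i))
        one-of : ∀ i → suc i ≤ T1 → vertex (path i) ∈ S ⊎ vertex (path (suc i)) ∈ S
        one-of i i<T1 with meets-triangle-at strong (<⇒≤ i<T1) i<T1 z≤n
                             (fwd (path-step i)) (bwd (hub _)) (bwd (hub _)) (λ d _ → path-triangle-maximal d)
        ... | inj₁ i∈S = inj₁ i∈S
        ... | inj₂ (inj₁ i+1∈S) = inj₂ i+1∈S
        ... | inj₂ (inj₂ hub∈S) = ⊥-elim (hub∉S hub∈S)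
        open Alternation (λ i → vertex (path i) ∈ S) T1 not-both one-of
        path-pattern : vertex (path T1) ∈ S ⇔ (even T1 ≡ true)
        path-pattern = alternation true (mk⇔ (λ _ → refl) (λ _ → head∈S)) T1 ≤-refl

      hole-K2∉S : vertex (hole K2) ∉ S
      hole-K2∉S K2∈S = true≢false (trans (sym K2-even) (Equivalence.to hole-pattern K2∈S))
        where
        not-both : ∀ i → suc i ≤ K2 → vertex (hole i) ∈ S → vertex (hole (suc i)) ∈ S → ⊥
        not-both i i<K2 i∈S i+1∈S = independent-at strong (<⇒≤ i<K2) i<K2 i∈S i+1∈S (fwd (hole-step i))
        one-of : ∀ i → suc i ≤ K2 → vertex (hole i) ∈ S ⊎ vertex (hole (suc i)) ∈ S
        one-of i i<K2 = meets-edge-at strong (<⇒≤ i<K2) i<K2 (fwd (hole-step i)) λ d _ → hole-step-maximal d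
        open Alternation (λ i → vertex (hole i) ∈ S) K2 not-both one-of
        hole-pattern : vertex (hole K2) ∈ S ⇔ (even K2 ≡ false)
        hole-pattern = alternation false (mk⇔ (λ hub∈S → ⊥-elim (hub∉S hub∈S)) λ ()) K2 ≤-refl

    head-not-forced : ∀ r → Valid r → r ≢ path 0 → ¬ Forced G (⊤ - vertex r) (vertex (path 0))
    head-not-forced r r-valid r≢head with cut r r-valid r≢head
    ... | q , J , 1≤q , cut-q-J , ≢r⇔uncut =
      not-forced G (setOf (gapped? q J) ,
                    strong-in-G-minus (gapped? q J) r-valid ≢r⇔uncut (gapped-pattern 1≤q cut-q-J) ,
                    ∈setOf⁺ (gapped? q J) z≤n (inj₁ (1≤q , refl)))
                   without-head
      where
      avoiding : ∀ {P} (P? : ∀ a → Dec (P a)) → StrongPattern Valid _⟶_ (λ _ → Unit) P → ¬ P r → ¬ P (path 0) →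
                 ∃ λ S → IsStrongStable G (⊤ - vertex r) S × vertex (path 0) ∉ S
      avoiding P? 𝒫 ¬Pr ¬Phead =
        setOf P? , strong-delete G (strong-in-G P? 𝒫) (λ r∈ → ¬Pr (∈setOf⁻ P? r-valid r∈)) ,
        λ head∈ → ¬Phead (∈setOf⁻ P? z≤n head∈)
      without-head : ∃ λ S → IsStrongStable G (⊤ - vertex r) S × vertex (path 0) ∉ S
      without-head with even-hole? r
      ... | no r-odd = avoiding even-hole? even-hole-pattern r-odd λ ()
      ... | yes r-even = avoiding odd-indexed? odd-indexed-pattern (even-hole-not-odd-indexed r r-even) λ ()

    head-undesirable : Undesirable G (vertex (path 0))
    head-undesirable = head-unwanted ,
      by-coordinates (λ u → u ≢ vertex (path 0) → ¬ Forced G (⊤ - u) (vertex (path 0)))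
                     λ r r-valid r≢head → head-not-forced r r-valid λ r≡head → r≢head (cong vertex r≡head)

pupa-undesirable : ∀ {n} (G : Graph n) v → IsPupa G v → Undesirable G v
pupa-undesirable G v (suc (suc K2) , t , k-even , s≤s (s≤s 2≤K2) , t+1-odd , model) =
  subst (Undesirable G) (proj₂ coordinates) (InPupa.head-undesirable (proj₁ coordinates))
  where
  K2-even : even K2 ≡ true
  K2-even = trans (sym (not-involutive (even K2))) (Even⇒even k-even)
  t-even : even t ≡ true
  t-even = not-injective (Odd⇒odd t+1-odd)
  open PupaModel K2 t 2≤K2 K2-even t-even
  coordinates : ∃ λ (𝒞 : Coordinatisation Valid _⟶_ G) → Coordinatisation.vertex 𝒞 (path 0) ≡ v
  coordinates = coordinatise model pupa-coding

module _ (k : ℕ) where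

  forget-path : PupaLabel k 0 → LarvaLabel k
  forget-path head = head
  forget-path (cyc i) = cyc i

  add-path : LarvaLabel k → PupaLabel k 0
  add-path head = head
  add-path (cyc i) = cyc i

  forget-add : ∀ a → forget-path (add-path a) ≡ a
  forget-add head = refl
  forget-add (cyc _) = refl

  forget-path-injective : ∀ a b → forget-path a ≡ forget-path b → a ≡ b
  forget-path-injective head head _ = refl
  forget-path-injective (cyc _) (cyc _) refl = refl

  cyc-position⁻ : ∀ {i x} → pupaPos {k} {0} (cyc i) ≡ just x → toℕ i ≡ 0 × x ≡ 1
  cyc-position⁻ {i} pos with toℕ i
  cyc-position⁻ {i} refl | zero = refl , refl

  cyc-position⁺ : ∀ {i} → toℕ i ≡ 0 → pupaPos {k} {0} (cyc i) ≡ just 1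
  cyc-position⁺ {i} i≡0 with toℕ i
  cyc-position⁺ {i} refl | zero = refl

  larva-edge⇒pupa-edge : ∀ a b → LarvaEdge k (forget-path a) (forget-path b) →
                         PupaEdge k 0 a b ⊎ PupaEdge k 0 b a
  larva-edge⇒pupa-edge (cyc i) (cyc j) i→j = inj₁ (inj₁ (i , j , refl , refl , i→j))
  larva-edge⇒pupa-edge head (cyc j) (inj₁ j≡0) = inj₁ (inj₂ (inj₁ (0 , refl , cyc-position⁺ j≡0)))
  larva-edge⇒pupa-edge head (cyc j) (inj₂ j≡1) = inj₂ (inj₂ (inj₂ (j , refl , j≡1 , 0 , refl)))

  pupa-edge⇒larva-edge : ∀ a b → PupaEdge k 0 a b →
                         LarvaEdge k (forget-path a) (forget-path b) ⊎ LarvaEdge k (forget-path b) (forget-path a)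
  pupa-edge⇒larva-edge _ _ (inj₁ (_ , _ , refl , refl , i→j)) = inj₁ i→j
  pupa-edge⇒larva-edge head (cyc j) (inj₂ (inj₁ (_ , refl , pos))) = inj₁ (inj₁ (proj₁ (cyc-position⁻ pos)))
  pupa-edge⇒larva-edge (cyc i) _ (inj₂ (inj₁ (_ , pos , pos′))) with cyc-position⁻ pos
  pupa-edge⇒larva-edge (cyc i) head (inj₂ (inj₁ (_ , _ , ()))) | _ , refl
  pupa-edge⇒larva-edge (cyc i) (cyc j) (inj₂ (inj₁ (_ , _ , pos′))) | _ , refl with cyc-position⁻ pos′
  ... | _ , ()
  pupa-edge⇒larva-edge (cyc i) head (inj₂ (inj₂ (_ , refl , i≡1 , _))) = inj₂ (inj₂ i≡1)
  pupa-edge⇒larva-edge (cyc i) (cyc j) (inj₂ (inj₂ (_ , refl , i≡1 , _ , pos))) =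
    inj₂ (inj₁ (trans (cong suc (proj₁ (cyc-position⁻ pos))) (sym i≡1)))

-- The hole c_1 ... c_k with c_2 complete to the path v - c_1 is a pupa with t = 0.
larva⇒pupa : ∀ {n} {G : Graph n} {v} → IsLarva G v → IsPupa G v
larva⇒pupa {G = G} (k , k-even , 4≤k , f , f-injective , f-surjective , f-head , f-adj) =
  k , 0 , k-even , 4≤k , (0 , refl) ,
  (λ a → f (forget-path k a)) ,
  (λ a b e → forget-path-injective k a b (f-injective _ _ e)) ,
  (λ x → add-path k (proj₁ (f-surjective x)) ,
         trans (cong f (forget-add k _)) (proj₂ (f-surjective x))) ,
  f-head ,
  λ a b → (λ ab → [ larva-edge⇒pupa-edge k a b , swap ∘ larva-edge⇒pupa-edge k b a ]′ (proj₁ (f-adj _ _) ab)) ,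
          (λ e → proj₂ (f-adj _ _) ([ pupa-edge⇒larva-edge k a b , swap ∘ pupa-edge⇒larva-edge k b a ]′ e))

-- Butterflies

-- path m is the vertex w_m of IsButterfly.
data ButterflyPoint : Set where
  apex : ButterflyPoint
  path : ℕ → ButterflyPoint

module ButterflyModel (α β γ : ℕ) (α-even : even α ≡ true) (2≤α : 2 ≤ α) (β-odd : even β ≡ false)
                      (γ-even : even γ ≡ true) (2≤γ : 2 ≤ γ) where

  B N : ℕ
  B = α + β
  N = α + β + γ

  ApexAdjacent : ℕ → Set
  ApexAdjacent m = m ≡ 0 ⊎ (α ≤ m × m ≤ B) ⊎ m ≡ N

  Valid : ButterflyPoint → Set
  Valid apex = Unit
  Valid (path m) = m ≤ N

  data _⟶_ : ButterflyPoint → ButterflyPoint → Set where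
    step  : ∀ m → path m ⟶ path (suc m)
    spoke : ∀ {m} → ApexAdjacent m → apex ⟶ path m

  infix 4 _~_
  _~_ : ButterflyPoint → ButterflyPoint → Set
  _~_ = SymClosure _⟶_

  path~path : ∀ {m m′} → path m ~ path m′ → Consecutive m m′
  path~path (fwd (step _)) = inj₁ refl
  path~path (bwd (step _)) = inj₂ refl

  apex~path : ∀ {m} → apex ~ path m → ApexAdjacent m
  apex~path (fwd (spoke adj)) = adj

  path~apex : ∀ {m} → path m ~ apex → ApexAdjacent m
  path~apex (bwd (spoke adj)) = adj

  ¬apex~apex : ¬ apex ~ apex
  ¬apex~apex (fwd ())
  ¬apex~apex (bwd ())

  B-odd : even B ≡ false
  B-odd = trans (even-+-odd α β-odd) (cong not α-even)

  N-odd : even N ≡ false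
  N-odd = trans (even-+-even B γ-even) B-odd

  α≤B : α ≤ B
  α≤B = m≤m+n α β

  B+1<N : suc B < N
  B+1<N = subst (_≤ N) (+-comm B 2) (+-monoʳ-≤ B 2≤γ)

  α≤N : α ≤ N
  α≤N = ≤-trans α≤B (≤-trans (n≤1+n B) (<⇒≤ B+1<N))

  0<α : 0 < α
  0<α = ≤-trans (s≤s z≤n) 2≤α

  0<N : 0 < N
  0<N = ≤-trans 0<α α≤N

  α≢1 : ∀ {m} → α ≤ m → m ≢ 1
  α≢1 α≤m refl = <⇒≱ 2≤α α≤m

  N≢1 : N ≢ 1
  N≢1 = α≢1 α≤N

  spokes-consecutive : ∀ {m} → suc m ≤ N → ApexAdjacent m → ApexAdjacent (suc m) → α ≤ m × suc m ≤ B
  spokes-consecutive _ (inj₂ (inj₁ (α≤m , _))) (inj₂ (inj₁ (_ , m+1≤B))) = α≤m , m+1≤B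
  spokes-consecutive _ (inj₁ refl) (inj₂ (inj₁ (α≤1 , _))) = ⊥-elim (α≢1 α≤1 refl)
  spokes-consecutive _ (inj₁ refl) (inj₂ (inj₂ 1≡N)) = ⊥-elim (N≢1 (sym 1≡N))
  spokes-consecutive _ (inj₂ (inj₁ (_ , m≤B))) (inj₂ (inj₂ m+1≡N)) =
    ⊥-elim (<-irrefl m+1≡N (≤-<-trans (s≤s m≤B) B+1<N))
  spokes-consecutive m<N (inj₂ (inj₂ refl)) _ = ⊥-elim (<-irrefl refl m<N)

  first-spoke-maximal : ∀ d → d ~ apex → d ~ path 0 → ⊥
  first-spoke-maximal apex d~apex _ = ¬apex~apex d~apex
  first-spoke-maximal (path _) d~apex d~0 with path~path d~0
  ... | inj₁ ()
  ... | inj₂ refl = <⇒≱ 0<α (proj₁ (spokes-consecutive 0<N (inj₁ refl) (path~apex d~apex)))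

  last-spoke-maximal : ∀ d → Valid d → d ~ apex → d ~ path N → ⊥
  last-spoke-maximal apex _ d~apex _ = ¬apex~apex d~apex
  last-spoke-maximal (path j) j≤N d~apex d~N with path~path d~N
  ... | inj₂ refl = <-irrefl refl j≤N
  ... | inj₁ j+1≡N = <⇒≱ (<-trans (n<1+n B) B+1<N) (subst (_≤ B) j+1≡N
          (proj₂ (spokes-consecutive (≤-reflexive j+1≡N) (path~apex d~apex) (inj₂ (inj₂ j+1≡N)))))

  step-maximal : ∀ {m} → suc m ≤ N → ¬ (α ≤ m × suc m ≤ B) → ∀ d → d ~ path m → d ~ path (suc m) → ⊥
  step-maximal _ _ (path _) d~m d~m+1 = consecutive-triangle-free (path~path d~m) (path~path d~m+1)
  step-maximal m<N outside apex d~m d~m+1 =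
    outside (spokes-consecutive m<N (apex~path d~m) (apex~path d~m+1))

  spoke-triangle-maximal : ∀ {m} d → d ~ path m → d ~ path (suc m) → d ~ apex → ⊥
  spoke-triangle-maximal (path _) d~m d~m+1 _ = consecutive-triangle-free (path~path d~m) (path~path d~m+1)
  spoke-triangle-maximal apex _ _ d~apex = ¬apex~apex d~apex

  apex-common-neighbour : ∀ {d m} → d ~ apex → d ~ path m → ∃ λ j → d ≡ path j × Consecutive j m
  apex-common-neighbour {apex} d~apex _ = ⊥-elim (¬apex~apex d~apex)
  apex-common-neighbour {path j} _ d~m = j , refl , path~path d~m

  module _ (q : ℕ) where

    Uncut : ButterflyPoint → Set
    Uncut apex = Unit
    Uncut (path m) = m ≢ q

    Gapped : ButterflyPoint → Set
    Gapped apex = ⊥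
    Gapped (path m) = Gap q true m

    gapped? : ∀ a → Dec (Gapped a)
    gapped? apex = no λ ()
    gapped? (path m) = gap? q true m

  cut : ∀ r → Valid r → r ≢ apex → ∃ λ q → q ≤ N × (∀ {a} → Valid a → (a ≢ r) ⇔ Uncut q a)
  cut apex _ r≢apex = ⊥-elim (r≢apex refl)
  cut (path q) q≤N _ = q , q≤N , uncut-path
    where
    uncut-path : ∀ {a} → Valid a → (a ≢ path q) ⇔ Uncut q a
    uncut-path {apex} _ = mk⇔ (λ _ → tt) (λ _ ())
    uncut-path {path _} _ = mk⇔ (λ ne e → ne (cong path e)) (λ ne → λ { refl → ne refl })

  module _ {q : ℕ} (q≤N : q ≤ N) where

    private
      no-common-at-apex : ∀ {m} → m ≢ q → ¬ Gapped q (path m) →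
                          ∀ d → Uncut q d → ¬ Gapped q d → d ~ apex → d ~ path m → ⊥
      no-common-at-apex m≢q ¬gap d d≢ ¬gap′ d~apex d~m with apex-common-neighbour d~apex d~m
      ... | _ , refl , inj₁ refl = gap-covers d≢ m≢q ¬gap′ ¬gap
      ... | _ , refl , inj₂ refl = gap-covers m≢q d≢ ¬gap ¬gap′

    gapped-pattern : StrongPattern Valid _⟶_ (Uncut q) (Gapped q)
    gapped-pattern = record
      { inside          = inside
      ; independent     = independent
      ; dominating      = dominating
      ; edge-dominating = edge-dominating
      }
      where
      inside : ∀ a → Valid a → Gapped q a → Uncut q a
      inside (path _) _ = gap-≢
      independent : ∀ a b → Valid a → Valid b → Gapped q a → Gapped q b → a ⟶ b → ⊥
      independent _ _ _ _ gap gap′ (step _) = gap-independent gap gap′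
      before-last : ∀ {m} → m ≤ N → q < m → ¬ Gapped q (path m) → m < N
      before-last m≤N q<m ¬gap = <-by-parity m≤N (¬gap-above ¬gap q<m) N-odd
      dominating : ∀ a → Valid a → Uncut q a → ¬ Gapped q a → ∃ λ b → Valid b × Gapped q b × b ~ a
      dominating apex _ _ _ with q ≟ 0
      ... | yes refl = path N , ≤-refl , inj₂ (0<N , N-odd) , bwd (spoke (inj₂ (inj₂ refl)))
      ... | no q≢0 = path 0 , z≤n , inj₁ (n≢0⇒n>0 q≢0 , refl) , bwd (spoke (inj₁ refl))
      dominating (path m) m≤N m≢q ¬gap with <-cmp m q
      ... | tri≈ _ m≡q _ = ⊥-elim (m≢q m≡q)
      ... | tri> _ _ q<m = path (suc m) , before-last m≤N q<m ¬gap , gap-next ¬gap q<m , bwd (step m)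
      dominating (path zero) _ _ ¬gap | tri< 0<q _ _ = ⊥-elim (¬gap (inj₁ (0<q , refl)))
      dominating (path (suc k)) m≤N _ ¬gap | tri< m<q _ _ =
        path k , <⇒≤ m≤N , gap-previous ¬gap m<q , fwd (step k)
      edge-dominating : ∀ a c → Valid a → Valid c → Uncut q a → Uncut q c → ¬ Gapped q a → ¬ Gapped q c → a ⟶ c →
        ∃ λ b → Valid b × Gapped q b × b ~ a × b ~ c ×
          (∀ d → Valid d → Uncut q d → ¬ Gapped q d → d ~ a → d ~ c → b ~ d)
      edge-dominating _ _ _ _ m≢q m+1≢q ¬gap ¬gap′ (step _) = ⊥-elim (gap-covers m≢q m+1≢q ¬gap ¬gap′)
      edge-dominating _ (path zero) _ _ _ 0≢q _ ¬gap (spoke _) =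
        ⊥-elim (¬gap (inj₁ (n≢0⇒n>0 (λ q≡0 → 0≢q (sym q≡0)) , refl)))
      edge-dominating _ (path m) _ m≤N _ m≢q _ ¬gap (spoke (inj₂ (inj₂ m≡N))) =
        ⊥-elim (true≢false (trans (sym (¬gap-above ¬gap q<m)) (trans (cong even m≡N) N-odd)))
        where
        q<m : q < m
        q<m = ≤∧≢⇒< (subst (q ≤_) (sym m≡N) q≤N) λ q≡m → m≢q (sym q≡m)
      edge-dominating _ (path m) _ m≤N _ m≢q _ ¬gap (spoke (inj₂ (inj₁ (α≤m , m≤B)))) with <-cmp m q
      ... | tri≈ _ m≡q _ = ⊥-elim (m≢q m≡q)
      ... | tri> _ _ q<m =
        path (suc m) , before-last m≤N q<m ¬gap , gap-next ¬gap q<m ,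
        bwd (spoke (inj₂ (inj₁ (≤-trans α≤m (n≤1+n m) , m<B)))) , bwd (step m) ,
        λ d _ d≢ ¬gap′ d~apex d~m → ⊥-elim (no-common-at-apex m≢q ¬gap d d≢ ¬gap′ d~apex d~m)
        where
        m<B : m < B
        m<B = <-by-parity m≤B (¬gap-above ¬gap q<m) B-odd
      edge-dominating _ (path zero) _ _ _ _ _ _ (spoke (inj₂ (inj₁ (α≤0 , _)))) | tri< _ _ _ =
        ⊥-elim (<⇒≱ 0<α α≤0)
      edge-dominating _ (path (suc k)) _ m≤N _ m≢q _ ¬gap (spoke (inj₂ (inj₁ (α≤m , m≤B)))) | tri< m<q _ _ =
        path k , <⇒≤ m≤N , gap-previous ¬gap m<q ,
        bwd (spoke (inj₂ (inj₁ (α≤k , <⇒≤ m≤B)))) , fwd (step k) ,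
        λ d _ d≢ ¬gap′ d~apex d~m → ⊥-elim (no-common-at-apex m≢q ¬gap d d≢ ¬gap′ d~apex d~m)
        where
        α≤k : α ≤ k
        α≤k = ≤-pred (<-by-parity α≤m α-even (¬gap-below ¬gap m<q))

  apex-adjacent? : ∀ m → Dec (ApexAdjacent m)
  apex-adjacent? m = (m ≟ 0) ⊎-dec (((α ≤? m) ×-dec (m ≤? B)) ⊎-dec (m ≟ N))

  interior : ∀ {m} → m ≤ N → ¬ ApexAdjacent m → (0 < m × m < α) ⊎ (B < m × m < N)
  interior {m} m≤N ¬adj with α ≤? m
  ... | no m<α = inj₁ (n≢0⇒n>0 (¬adj ∘ inj₁) , ≰⇒> m<α)
  ... | yes α≤m with B <? m
  ...   | yes B<m = inj₂ (B<m , ≤∧≢⇒< m≤N (¬adj ∘ inj₂ ∘ inj₂))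
  ...   | no m≤B = ⊥-elim (¬adj (inj₂ (inj₁ (α≤m , ≮⇒≥ m≤B))))

  InA : ℕ → Set
  InA m = even m ≡ false × m < α

  InC : ℕ → Set
  InC m = even m ≡ true × B < m × m < N

  module _ (q : ℕ) where

    WithApex : ButterflyPoint → Set
    WithApex apex = Unit
    WithApex (path m) = m ≢ q × (InA m ⊎ InC m)

    with-apex? : ∀ a → Dec (WithApex a)
    with-apex? apex = yes tt
    with-apex? (path m) = ¬? (m ≟ q) ×-dec (((even m ≟ᵇ false) ×-dec (m <? α)) ⊎-dec
                                            ((even m ≟ᵇ true) ×-dec ((B <? m) ×-dec (m <? N))))

    private
      unmarked-edge-on-b : ∀ m → suc m ≤ N → m ≢ q → suc m ≢ q →
                           ¬ WithApex (path m) → ¬ WithApex (path (suc m)) → α ≤ m × suc m ≤ B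
      unmarked-edge-on-b m m<N m≢q m+1≢q ¬P ¬P′ with α ≤? m | even-or-odd m
      ... | no m≱α | inj₂ parity = ⊥-elim (¬P (m≢q , inj₁ (parity , ≰⇒> m≱α)))
      ... | no m≱α | inj₁ parity = ⊥-elim (¬P′ (m+1≢q , inj₁ (cong not parity , m+1<α)))
        where
        m+1<α : suc m < α
        m+1<α = <-by-parity (≰⇒> m≱α) (cong not parity) α-even
      ... | yes α≤m | _ with suc m ≤? B
      ...   | yes m<B = α≤m , m<B
      ...   | no m≮B with m ≟ B | even-or-odd m
      ...     | yes refl | _ = ⊥-elim (¬P′ (m+1≢q , inj₂ (cong not B-odd , n<1+n B , B+1<N)))
      ...     | no m≢B | inj₁ parity = ⊥-elim (¬P (m≢q , inj₂ (parity , B<m , m<N)))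
        where
        B<m : B < m
        B<m = ≤∧≢⇒< (≤-pred (≰⇒> m≮B)) (λ B≡m → m≢B (sym B≡m))
      ...     | no m≢B | inj₂ parity = ⊥-elim (¬P′ (m+1≢q , inj₂ (cong not parity , <-trans B<m (n<1+n m) , m+1<N)))
        where
        B<m : B < m
        B<m = ≤∧≢⇒< (≤-pred (≰⇒> m≮B)) (λ B≡m → m≢B (sym B≡m))
        m+1<N : suc m < N
        m+1<N = <-by-parity m<N (cong not parity) N-odd

    with-apex-pattern : StrongPattern Valid _⟶_ (Uncut q) WithApex
    with-apex-pattern = record
      { inside          = inside
      ; independent     = independent
      ; dominating      = dominating
      ; edge-dominating = edge-dominating
      }
      where
      inside : ∀ a → Valid a → WithApex a → Uncut q a
      inside apex _ _ = tt
      inside (path _) _ = proj₁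
      independent : ∀ a b → Valid a → Valid b → WithApex a → WithApex b → a ⟶ b → ⊥
      independent _ _ _ _ (_ , inj₁ (m-odd , _)) (_ , inj₁ (m+1-odd , _)) (step _) =
        true≢false (trans (sym (cong not m-odd)) m+1-odd)
      independent _ _ _ _ (_ , inj₂ (m-even , _)) (_ , inj₂ (m+1-even , _)) (step _) =
        true≢false (trans (sym m+1-even) (cong not m-even))
      independent _ _ _ _ (_ , inj₁ (_ , m<α)) (_ , inj₂ (_ , B<m+1 , _)) (step _) =
        <⇒≱ m<α (≤-trans α≤B (≤-pred B<m+1))
      independent _ _ _ _ (_ , inj₂ (_ , B<m , _)) (_ , inj₁ (_ , m+1<α)) (step _) =
        <⇒≱ (<-trans B<m (n<1+n _)) (≤-trans (<⇒≤ m+1<α) α≤B)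
      independent _ _ _ _ _ (_ , inj₁ (() , _)) (spoke (inj₁ refl))
      independent _ _ _ _ _ (_ , inj₂ (_ , () , _)) (spoke (inj₁ refl))
      independent _ _ _ _ _ (_ , inj₁ (_ , m<α)) (spoke (inj₂ (inj₁ (α≤m , _)))) = <⇒≱ m<α α≤m
      independent _ _ _ _ _ (_ , inj₂ (_ , B<m , _)) (spoke (inj₂ (inj₁ (_ , m≤B)))) = <⇒≱ B<m m≤B
      independent _ _ _ _ _ (_ , inj₁ (_ , m<α)) (spoke (inj₂ (inj₂ refl))) = <⇒≱ m<α α≤N
      independent _ _ _ _ _ (_ , inj₂ (_ , _ , m<N)) (spoke (inj₂ (inj₂ refl))) = <-irrefl refl m<N
      dominating : ∀ a → Valid a → Uncut q a → ¬ WithApex a → ∃ λ b → Valid b × WithApex b × b ~ a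
      dominating apex _ _ ¬P = ⊥-elim (¬P tt)
      dominating (path m) m≤N m≢q ¬P with apex-adjacent? m
      ... | yes adj = apex , tt , tt , fwd (spoke adj)
      ... | no ¬adj with interior m≤N ¬adj
      dominating (path (suc k)) m≤N m≢q ¬P | no _ | inj₁ (_ , m<α) with k ≟ q
      ...   | no k≢q =
        path k , <⇒≤ m≤N , (k≢q , inj₁ (not-injective m-even , <-trans (n<1+n k) m<α)) , fwd (step k)
        where
        m-even : even (suc k) ≡ true
        m-even = ¬-not λ m-odd → ¬P (m≢q , inj₁ (m-odd , m<α))
      ...   | yes refl =
        path (suc (suc k)) , <⇒≤ (<-≤-trans m+2<α α≤N) ,
        ((λ e → <-irrefl (sym e) (<-trans (n<1+n k) (n<1+n (suc k)))) , inj₁ (cong not m-even , m+2<α)) ,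
        bwd (step (suc k))
        where
        m-even : even (suc k) ≡ true
        m-even = ¬-not λ m-odd → ¬P (m≢q , inj₁ (m-odd , m<α))
        m+2<α : suc (suc k) < α
        m+2<α = <-by-parity m<α (cong not m-even) α-even
      dominating (path m) m≤N m≢q ¬P | no _ | inj₂ (B<m , m<N) with suc m ≟ q
      ...   | no m+1≢q =
        path (suc m) , m<N , (m+1≢q , inj₂ (cong not m-odd , <-trans B<m (n<1+n m) , m+1<N)) , bwd (step m)
        where
        m-odd : even m ≡ false
        m-odd = ¬-not λ m-even → ¬P (m≢q , inj₂ (m-even , B<m , m<N))
        m+1<N : suc m < N
        m+1<N = <-by-parity m<N (cong not m-odd) N-odd
      dominating (path (suc k)) _ m≢q ¬P | no _ | inj₂ (B<m , m<N) | yes m+1≡q =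
        path k , <⇒≤ (<⇒≤ m<N) ,
        ((λ k≡q → <-irrefl (trans k≡q (sym m+1≡q)) (<-trans (n<1+n k) (n<1+n (suc k)))) ,
         inj₂ (not-injective m-odd , B<k , <-trans (n<1+n k) m<N)) ,
        fwd (step k)
        where
        m-odd : even (suc k) ≡ false
        m-odd = ¬-not λ m-even → ¬P (m≢q , inj₂ (m-even , B<m , m<N))
        B<k : B < k
        B<k = <-by-parity (≤-pred B<m) B-odd (not-injective m-odd)
      edge-dominating : ∀ a c → Valid a → Valid c → Uncut q a → Uncut q c → ¬ WithApex a → ¬ WithApex c → a ⟶ c →
        ∃ λ b → Valid b × WithApex b × b ~ a × b ~ c ×
          (∀ d → Valid d → Uncut q d → ¬ WithApex d → d ~ a → d ~ c → b ~ d)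
      edge-dominating _ _ _ _ _ _ ¬P _ (spoke _) = ⊥-elim (¬P tt)
      edge-dominating _ _ _ m+1≤N m≢q m+1≢q ¬P ¬P′ (step m) =
        apex , tt , tt ,
        fwd (spoke (inj₂ (inj₁ (α≤m , <⇒≤ m<B)))) , fwd (spoke (inj₂ (inj₁ (≤-trans α≤m (n≤1+n m) , m<B)))) ,
        no-common
        where
        no-common : ∀ d → Valid d → Uncut q d → ¬ WithApex d → d ~ path m → d ~ path (suc m) → apex ~ d
        no-common apex _ _ ¬P″ _ _ = ⊥-elim (¬P″ tt)
        no-common (path _) _ _ _ d~m d~m+1 = ⊥-elim (consecutive-triangle-free (path~path d~m) (path~path d~m+1))
        b-edge : α ≤ m × suc m ≤ B
        b-edge = unmarked-edge-on-b m m+1≤N m≢q m+1≢q ¬P ¬P′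
        α≤m : α ≤ m
        α≤m = proj₁ b-edge
        m<B : suc m ≤ B
        m<B = proj₂ b-edge

  toℕ-path : ∀ {m} → m ≤ N → toℕ (m mod suc N) ≡ m
  toℕ-path m≤N = trans (toℕ-fromℕ< _) (m≤n⇒m%n≡m m≤N)

  encode : ButterflyLabel N → ButterflyPoint
  encode head = apex
  encode (w i) = path (toℕ i)

  decode : ButterflyPoint → ButterflyLabel N
  decode apex = head
  decode (path m) = w (m mod suc N)

  encode-edge : ∀ {a b} → ButterflyEdge α β γ a b → encode a ~ encode b
  encode-edge {w i} {w _} i→j = subst (λ m → path (toℕ i) ~ path m) i→j (fwd (step (toℕ i)))
  encode-edge {head} {w _} adj = fwd (spoke adj)

  decode-edge : ∀ {x y} → Valid x → Valid y → x ⟶ y →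
                ButterflyEdge α β γ (decode x) (decode y) ⊎ ButterflyEdge α β γ (decode y) (decode x)
  decode-edge m≤N m+1≤N (step _) = inj₁ (trans (cong suc (toℕ-path m≤N)) (sym (toℕ-path m+1≤N)))
  decode-edge _ m≤N (spoke adj) = inj₁ (subst ApexAdjacent (sym (toℕ-path m≤N)) adj)

  encode-valid : ∀ a → Valid (encode a)
  encode-valid head = tt
  encode-valid (w i) = ≤-pred (toℕ<n i)

  decode-encode : ∀ a → decode (encode a) ≡ a
  decode-encode head = refl
  decode-encode (w i) = cong w (toℕ-injective (toℕ-path (≤-pred (toℕ<n i))))

  encode-decode : ∀ {x} → Valid x → encode (decode x) ≡ x
  encode-decode {apex} _ = refl
  encode-decode {path _} m≤N = cong path (toℕ-path m≤N)

  butterfly-coding : Coding (ButterflyLabel N) (ButterflyEdge α β γ) Valid _⟶_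
  butterfly-coding = record
    { encode        = encode
    ; decode        = decode
    ; encode-valid  = encode-valid
    ; decode-encode = decode-encode
    ; encode-decode = encode-decode
    ; encode-edge   = encode-edge
    ; decode-edge   = decode-edge
    }

  module InButterfly {n : ℕ} {G : Graph n} (𝒞 : Coordinatisation Valid _⟶_ G) where
    open Coordinatisation 𝒞
    open InCoordinates 𝒞

    apex-wanted : Wanted G ⊤ (vertex apex)
    apex-wanted S strong with vertex apex ∈? S
    ... | yes apex∈S = apex∈S
    ... | no apex∉S with meets-edge-at strong tt ≤-refl (fwd (spoke (inj₂ (inj₂ refl)))) last-spoke-maximal
    ...   | inj₁ apex∈S = apex∈S
    ...   | inj₂ last∈S = ⊥-elim (true≢false (trans (sym (Equivalence.to path-pattern last∈S)) N-odd))
      where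
      first∈S : vertex (path 0) ∈ S
      first∈S = [ (λ apex∈S → ⊥-elim (apex∉S apex∈S)) , (λ 0∈S → 0∈S) ]′
                  (meets-edge-at strong tt z≤n (fwd (spoke (inj₁ refl))) λ d _ → first-spoke-maximal d)
      not-both : ∀ m → suc m ≤ N → vertex (path m) ∈ S → vertex (path (suc m)) ∈ S → ⊥
      not-both m m<N m∈S m+1∈S = independent-at strong (<⇒≤ m<N) m<N m∈S m+1∈S (fwd (step m))
      one-of : ∀ m → suc m ≤ N → vertex (path m) ∈ S ⊎ vertex (path (suc m)) ∈ S
      one-of m m<N with (α ≤? m) ×-dec (suc m ≤? B)
      ... | no outside = meets-edge-at strong (<⇒≤ m<N) m<N (fwd (step m)) λ d _ → step-maximal m<N outside d
      ... | yes (α≤m , m<B) with meets-triangle-at strong (<⇒≤ m<N) m<N tt (fwd (step m))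
                                   (bwd (spoke (inj₂ (inj₁ (≤-trans α≤m (n≤1+n m) , m<B)))))
                                   (bwd (spoke (inj₂ (inj₁ (α≤m , <⇒≤ m<B)))))
                                   (λ d _ → spoke-triangle-maximal d)
      ...   | inj₁ m∈S = inj₁ m∈S
      ...   | inj₂ (inj₁ m+1∈S) = inj₂ m+1∈S
      ...   | inj₂ (inj₂ apex∈S) = ⊥-elim (apex∉S apex∈S)
      open Alternation (λ m → vertex (path m) ∈ S) N not-both one-of
      path-pattern : vertex (path N) ∈ S ⇔ (even N ≡ true)
      path-pattern = alternation true (mk⇔ (λ _ → refl) (λ _ → first∈S)) N ≤-refl

    apex-not-forced : ∀ r → Valid r → r ≢ apex → ¬ Forced G (⊤ - vertex r) (vertex apex)
    apex-not-forced r r-valid r≢apex with cut r r-valid r≢apex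
    ... | q , q≤N , ≢r⇔uncut =
      not-forced G (setOf (with-apex? q) ,
                    strong-in-G-minus (with-apex? q) r-valid ≢r⇔uncut (with-apex-pattern q) ,
                    ∈setOf⁺ (with-apex? q) tt tt)
                   (setOf (gapped? q) ,
                    strong-in-G-minus (gapped? q) r-valid ≢r⇔uncut (gapped-pattern q≤N) ,
                    ∈setOf⁻ (gapped? q) tt)

    apex-desirable : Desirable G (vertex apex)
    apex-desirable = apex-wanted ,
      by-coordinates (λ u → u ≢ vertex apex → ¬ Forced G (⊤ - u) (vertex apex))
                     λ r r-valid r≢apex → apex-not-forced r r-valid λ r≡apex → r≢apex (cong vertex r≡apex)

butterfly-desirable : ∀ {n} (G : Graph n) u → IsButterfly G u → Desirable G u
butterfly-desirable G u (α , β , γ , α-even , 2≤α , β-odd , γ-even , 2≤γ , model) =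
  subst (Desirable G) (proj₂ coordinates) (InButterfly.apex-desirable (proj₁ coordinates))
  where
  open ButterflyModel α β γ (Even⇒even α-even) 2≤α (Odd⇒odd β-odd) (Even⇒even γ-even) 2≤γ
  coordinates : ∃ λ (𝒞 : Coordinatisation Valid _⟶_ G) → Coordinatisation.vertex 𝒞 apex ≡ u
  coordinates = coordinatise model butterfly-coding

mainTheorem4 : ((n : ℕ) (D : Graph n) (v : Fin n) →
                 IsLarva D v ⊎ IsPupa D v → Undesirable D v)
               × ((n : ℕ) (T : Graph n) (u : Fin n) →
                 IsButterfly T u → Desirable T u)
mainTheorem4 = larva-or-pupa , λ _ T u → butterfly-desirable T u
  where
  larva-or-pupa : (n : ℕ) (D : Graph n) (v : Fin n) → IsLarva D v ⊎ IsPupa D v → Undesirable D v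
  larva-or-pupa _ D v (inj₁ larva) = pupa-undesirable D v (larva⇒pupa {G = D} larva)
  larva-or-pupa _ D v (inj₂ pupa) = pupa-undesirable D v pupa
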